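{- For a total order $\lhd$ (on $[n]$ for some $n\ge0$) let $G^I_\lhd=\sum F_\prec$ over all $\prec\in\mathrm{IPos}$ with $\mathrm{e}_I(\prec)=\lhd$, and $G^D_\lhd=\sum F_\prec$ over all $\prec\in\mathrm{IPos}$ with $\mathrm{e}_D(\prec)=\lhd$. The linear spans of $\{G^I_\lhd\}$ and of $\{G^D_\lhd\}$ (over all total orders $\lhd$) are each stable under the product and coproduct of $\mathbb{K}\mathrm{IPos}$, and thus are Hopf subalgebras of $(\mathbb{K}\mathrm{IPos},\cdot,\Delta)$.
   Context: For $n\ge0$ let $[n]=\{1,\dots,n\}$. An integer poset of size $n$ is a reflexive antisymmetric transitive relation $\prec$ on $[n]$; $\mathrm{IPos}=\bigsqcup_n\mathrm{IPos}_n$; write $a\succ b$ for $b\prec a$. For a poset $\prec$ define $\mathrm{d}_I(\prec)=\prec\setminus\{(a,c): a<c,\ \exists\,a<b_1<\dots<b_k<c$ ($k\ge1$) with $a\not\prec b_1\not\prec\dots\not\prec b_k\not\prec c\}$, $\mathrm{d}_D(\prec)=\prec\setminus\{(c,a):a<c,\ \exists\,a<b_1<\dots<b_k<c$ ($k\ge1$) with $a\not\succ b_1\not\succ\dots\not\succ b_k\not\succ c\}$, $\max(\prec)=\prec\cup\{(b,a):a<b\text{ incomparable in }\prec\}$, $\min(\prec)=\prec\cup\{(a,b):a<b\text{ incomparable}\}$, $\mathrm{e}_I(\prec)=\max(\mathrm{d}_I(\prec))$, $\mathrm{e}_D(\prec)=\min(\mathrm{d}_D(\prec))$ (total orders). For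 $R$ of size $n$ and $X=\{x_1<\dots<x_k\}\subseteq[n]$, $R_X=\{(i,j)\in[k]^2:(x_i,x_j)\in R\}$. For $S$ of size $n$, $m\ge0$: $\overline{S}=\{(m+i,m+j):(i,j)\in S\}$, $\overline{[n]}=\{m+1,\dots,m+n\}$; for $R$ of size $m$, $\mathrm{Sh}(R,S)$ is the set of all $R\cup\overline{S}\cup I\cup D$ with $I\subseteq[m]\times\overline{[n]}$, $D\subseteq\overline{[n]}\times[m]$. A total cut of $T$ on $[p]$ is a partition $[p]=X\sqcup Y$ with $(x,y)\in T$, $(y,x)\notin T$ for all $x\in X,y\in Y$; $R\star S$ is the set of relations $T$ on $[m+n]$ admitting a total cut $(X,Y)$ with $T_X=R$, $T_Y=S$. $(\mathbb{K}\mathrm{IPos},\cdot,\Delta)$ is the Hopf algebra with basis $(F_\prec)_{\prec\in\mathrm{IPos}}$, product $F_\prec\cdot F_\lhd=\sum_{T\in\mathrm{Sh}(\prec,\lhd)\cap\mathrm{IPos}}F_T$, coproduct $\Delta(F_T)=\sum_{(R,S):T\in R\star S}F_R\otimes F_S$. -}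

module Defs where

open import Level using (Level; _⊔_)
import Level
open import Data.Bool using (Bool; true; false; _∧_; _∨_; not; if_then_else_)
open import Data.Nat as ℕ using (ℕ; zero; suc; _+_; _∸_)
open import Data.Fin as Fin using (Fin; splitAt)
open import Data.Fin.Properties using (all?) renaming (_<?_ to _<?ᶠ_; _≟_ to _≟ᶠ_)
open import Data.List using (List; []; _∷_; _++_; map; concatMap; allFin; upTo; foldr; filterᵇ; length; lookup)
open import Data.List.Relation.Unary.All using (All)
open import Data.Bool.ListAction using (any; all)
open import Data.Product using (Σ; ∃; ∃-syntax; _×_; _,_; proj₁; proj₂)
open import Data.Sum using (_⊎_; inj₁; inj₂)
open import Relation.Binary.PropositionalEquality using (_≡_; refl)
open import Relation.Nullary using (¬_; Dec; yes; no; does)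
open import Relation.Nullary.Decidable using (_×-dec_; _⊎-dec_; _→-dec_; map′)
open import Algebra.Bundles using (CommutativeRing)
open import Data.Bool.Properties using () renaming (_≟_ to _≟ᵇ_)

-- Relations on [n], represented on Fin n = {0,…,n-1} (element k ↔ k+1,
-- same natural order).  A relation is its characteristic function:
-- R a b ≡ true  iff  (a,b) ∈ R.

Rel : ℕ → Set
Rel n = Fin n → Fin n → Bool

_<ᵇ_ : ∀ {n} → Fin n → Fin n → Bool
a <ᵇ b = does (a <?ᶠ b)

record IsPoset {n : ℕ} (P : Rel n) : Set where
  field
    reflexive     : ∀ a → P a a ≡ true
    antisymmetric : ∀ a b → P a b ≡ true → P b a ≡ true → a ≡ b
    transitive    : ∀ a b c → P a b ≡ true → P b c ≡ true → P a c ≡ true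

record IsTotalOrder {n : ℕ} (P : Rel n) : Set where
  field
    isPoset : IsPoset P
    total   : ∀ a b → P a b ≡ true ⊎ P b a ≡ true

isPoset? : ∀ {n} (P : Rel n) → Dec (IsPoset P)
isPoset? P =
  map′ (λ { (r , a , t) → record { reflexive = r ; antisymmetric = a ; transitive = t } })
       (λ p → IsPoset.reflexive p , IsPoset.antisymmetric p , IsPoset.transitive p)
       (all? (λ a → P a a ≟ᵇ true)
        ×-dec all? (λ a → all? (λ b → (P a b ≟ᵇ true) →-dec ((P b a ≟ᵇ true) →-dec (a ≟ᶠ b))))
        ×-dec all? (λ a → all? (λ b → all? (λ c →
                 (P a b ≟ᵇ true) →-dec ((P b c ≟ᵇ true) →-dec (P a c ≟ᵇ true))))))

isPosetᵇ : ∀ {n} → Rel n → Bool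
isPosetᵇ P = does (isPoset? P)

-- Equality of relations of possibly different sizes (size equal and
-- pointwise equal).  Elements of ∃ Rel are the basis labels.

Basis : Set
Basis = Σ ℕ Rel

sameᵇ : Basis → Basis → Bool
sameᵇ (m , P) (n , Q) with m ℕ.≟ n
... | yes refl = does (all? (λ i → all? (λ j → P i j ≟ᵇ Q i j)))
... | no _     = false

edgeI edgeD : ∀ {n} → Rel n → Fin n → Fin n → Bool
edgeI P x y = (x <ᵇ y) ∧ not (P x y)
edgeD P x y = (x <ᵇ y) ∧ not (P y x)

-- walk E k x y : there is a sequence x = y₀ < y₁ < … < y_r = y with
-- 1 ≤ r ≤ k+1 and E y_{i} y_{i+1} for all i (E already forces <).
walk : ∀ {n} → (Fin n → Fin n → Bool) → ℕ → Fin n → Fin n → Bool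
walk E zero    x y = E x y
walk {n} E (suc k) x y = E x y ∨ any (λ b → E x b ∧ walk E k b y) (allFin n)

-- chain E a c : there exist k ≥ 1 and a < b₁ < … < b_k < c with
-- E a b₁, E b₁ b₂, …, E b_k c.  Since a strictly increasing sequence in
-- [n] has at most n terms, fuel n makes this search exhaustive.
chain : ∀ {n} → (Fin n → Fin n → Bool) → Fin n → Fin n → Bool
chain {n} E a c = any (λ b → E a b ∧ walk E n b c) (allFin n)

-- d_I(≺) = ≺ ∖ {(a,c) : a < c, ∃ a<b₁<…<b_k<c, k≥1, a⊀b₁⊀…⊀b_k⊀c}
dI : ∀ {n} → Rel n → Rel n
dI P a c = P a c ∧ not ((a <ᵇ c) ∧ chain (edgeI P) a c)

-- d_D(≺) = ≺ ∖ {(c,a) : a < c, ∃ a<b₁<…<b_k<c, k≥1, a⊁b₁⊁…⊁b_k⊁c}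
dD : ∀ {n} → Rel n → Rel n
dD P c a = P c a ∧ not ((a <ᵇ c) ∧ chain (edgeD P) a c)

incomp : ∀ {n} → Rel n → Fin n → Fin n → Bool
incomp P a b = not (P a b) ∧ not (P b a)

maxR : ∀ {n} → Rel n → Rel n
maxR P x y = P x y ∨ ((y <ᵇ x) ∧ incomp P y x)

minR : ∀ {n} → Rel n → Rel n
minR P x y = P x y ∨ ((x <ᵇ y) ∧ incomp P x y)

eI eD : ∀ {n} → Rel n → Rel n
eI P = maxR (dI P)
eD P = minR (dD P)

allFuns : ∀ {A : Set} (k : ℕ) → List A → List (Fin k → A)
allFuns zero    xs = (λ ()) ∷ []
allFuns (suc k) xs =
  concatMap (λ a → map (λ f → λ { Fin.zero → a ; (Fin.suc i) → f i }) (allFuns k xs)) xs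

bools : List Bool
bools = true ∷ false ∷ []

allSubsets : (k : ℕ) → List (Fin k → Bool)
allSubsets k = allFuns k bools

allRel : (n : ℕ) → List (Rel n)
allRel n = allFuns n (allFuns n bools)

-- Shuffles: Sh(R,S) = { R ∪ S̄ ∪ I ∪ D : I ⊆ [m]×[n]‾, D ⊆ [n]‾×[m] }.
-- Fin (m + n) splits (splitAt) into [m] (inj₁) and [n]‾ = {m+1,…,m+n} (inj₂);
-- R, S̄, I, D live on the four disjoint blocks, so the union is:

shuffle : ∀ {m n} → Rel m → Rel n → (Fin m → Fin n → Bool) → (Fin n → Fin m → Bool) → Rel (m + n)
shuffle {m} R S I D x y with splitAt m x | splitAt m y
... | inj₁ i | inj₁ j = R i j
... | inj₂ i | inj₂ j = S i j
... | inj₁ i | inj₂ j = I i j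
... | inj₂ i | inj₁ j = D i j

-- the list of all elements of Sh(R,S) (distinct (I,D) give distinct relations)
Sh : ∀ {m n} → Rel m → Rel n → List (Rel (m + n))
Sh {m} {n} R S =
  concatMap (λ I → map (λ D → shuffle R S I D) (allFuns n (allFuns m bools)))
            (allFuns m (allFuns n bools))

elems : ∀ {p} → (Fin p → Bool) → List (Fin p)
elems {p} X = filterᵇ X (allFin p)

restrict : ∀ {p} → Rel p → (Fin p → Bool) → Basis
restrict T X = length (elems X) , λ i j → T (lookup (elems X) i) (lookup (elems X) j)

totalCutᵇ : ∀ {p} → Rel p → (Fin p → Bool) → Bool
totalCutᵇ {p} T X =
  all (λ x → all (λ y → not (X x ∧ not (X y)) ∨ (T x y ∧ not (T y x))) (allFin p)) (allFin p)

inStarᵇ : ∀ {p} → Rel p → Basis → Basis → Bool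
inStarᵇ {p} T R S =
  any (λ X → totalCutᵇ T X ∧ sameᵇ (restrict T X) R ∧ sameᵇ (restrict T (λ x → not (X x))) S)
      (allSubsets p)

starPairs : ∀ {p} → Rel p → List (Basis × Basis)
starPairs {p} T =
  concatMap (λ m →
    concatMap (λ R →
      concatMap (λ S → if inStarᵇ T (m , R) (p ∸ m , S) then ((m , R) , (p ∸ m , S)) ∷ [] else [])
                (allRel (p ∸ m)))
      (allRel m))
    (upTo (suc p))

-- The Hopf algebra 𝕂IPos, with coefficients in a commutative ring K
-- (the theorem is stated for K a field, see IsField).

IsField : ∀ {c ℓ} → CommutativeRing c ℓ → Set (c ⊔ ℓ)
IsField K = (¬ (1# ≈ 0#)) × (∀ x → ¬ (x ≈ 0#) → ∃[ y ] (x * y ≈ 1#))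
  where open CommutativeRing K

module Alg {c ℓ} (K : CommutativeRing c ℓ) where
  open CommutativeRing K renaming (Carrier to 𝕂; _+_ to _+ₖ_)

  -- Elements of 𝕂IPos as formal finite linear combinations Σ aᵢ F_{Pᵢ}
  -- (listed as (aᵢ , Pᵢ)); two are equal when all coefficients agree.
  Elt : Set c
  Elt = List (𝕂 × Basis)

  coeff : Elt → Basis → 𝕂
  coeff x T = foldr (λ { (a , P) r → if sameᵇ P T then a +ₖ r else r }) 0# x

  _≋_ : Elt → Elt → Set ℓ
  x ≋ y = ∀ T → coeff x T ≈ coeff y T

  _•_ : 𝕂 → Elt → Elt
  a • x = map (λ { (b , P) → a * b , P }) x

  _·_ : Elt → Elt → Elt
  x · y = concatMap (λ { (a , (m , R)) →
            concatMap (λ { (b , (n , S)) →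
              map (λ T → a * b , (m ℕ.+ n , T)) (filterᵇ isPosetᵇ (Sh R S)) }) y }) x

  Elt₂ : Set c
  Elt₂ = List (𝕂 × Basis × Basis)

  coeff₂ : Elt₂ → Basis → Basis → 𝕂
  coeff₂ z R S = foldr (λ { (a , R′ , S′) r → if sameᵇ R′ R ∧ sameᵇ S′ S then a +ₖ r else r }) 0# z

  _≋₂_ : Elt₂ → Elt₂ → Set ℓ
  z ≋₂ w = ∀ R S → coeff₂ z R S ≈ coeff₂ w R S

  _•₂_ : 𝕂 → Elt₂ → Elt₂
  a •₂ z = map (λ { (b , R , S) → a * b , R , S }) z

  _⊗_ : Elt → Elt → Elt₂
  x ⊗ y = concatMap (λ { (a , R) → map (λ { (b , S) → a * b , R , S }) y }) x

  Δ : Elt → Elt₂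
  Δ x = concatMap (λ { (a , (p , T)) → map (λ { (R , S) → a , R , S }) (starPairs T) }) x

  G : (∀ {n} → Rel n → Rel n) → ∀ {n} → Rel n → Elt
  G e {n} L = map (λ P → 1# , (n , P)) (filterᵇ (λ P → isPosetᵇ P ∧ sameᵇ (n , e P) (n , L)) (allRel n))

  InSpan : (∀ {n} → Rel n → Rel n) → Elt → Set (c ⊔ ℓ)
  InSpan e x = Σ (List (𝕂 × Basis)) λ L → (All {p = Level.zero} (λ { (a , (n , ν)) → IsTotalOrder ν }) L
                       × x ≋ concatMap (λ { (a , (n , ν)) → a • G e ν }) L)

  -- z lies in span{G^e} ⊗ span{G^e} = span { G^e_⊲ ⊗ G^e_⊲′ }
  InSpan₂ : (∀ {n} → Rel n → Rel n) → Elt₂ → Set (c ⊔ ℓ)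
  InSpan₂ e z = Σ (List (𝕂 × Basis × Basis)) λ L → (All {p = Level.zero} (λ { (a , (m , α) , (n , β)) → IsTotalOrder α × IsTotalOrder β }) L
                       × z ≋₂ concatMap (λ { (a , (m , α) , (n , β)) → a •₂ (G e α ⊗ G e β) }) L)

module Submission where

open import Defs
open import Data.Product using (_×_; _,_)
open import Algebra.Bundles using (CommutativeRing)
open import Data.Nat using (ℕ)

-- Both e = e_I and e = e_D are *admissible* (record Admissible below): for
-- every poset T, e(T) is a total order; e respects pointwise equality of
-- relations; e commutes with restriction to the initial block [m] and the
-- final block [n]‾ of [m+n]; and every total cut of T is a total cut of e(T),
-- e commuting with restriction to both sides of the cut.
--
-- The second half works for any admissible e and any commutative ring K.  Elements are compared through their
-- coefficients, which are finite sums over the enumerations of Defs, and the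
-- theorem follows linearly from two identities between basis elements:
--   product rule    G_α · G_β = Σ { G_γ : γ total, γ|[m] = α, γ|[n]‾ = β },
--   coproduct rule  Δ G_γ     = Σ { G_α ⊗ G_β : α, β total, γ ∈ α ⋆ β }.
-- The first holds because a shuffle is determined by its four blocks and
-- e commutes with restriction to the diagonal blocks; the second because
-- for a total cut of γ there is exactly one poset P with e(P) = γ whose two
-- sides are prescribed posets (it is glued from them along the cut).

-- Naming: "∧T₁"
-- eliminates (from a ∧ b ≡ true), "T∧" introduces (to a ∧ b ≡ true), etc.
module Bookkeeping where

  open import Defs
  open import Data.Bool using (Bool; true; false; _∧_; _∨_; not)
  open import Data.Nat as ℕ using (ℕ; _≡ᵇ_) renaming (_<ᵇ_ to _<ᴺ_)
  open import Data.Bool.Properties using (T-≡)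
  open import Function.Bundles using (module Equivalence)
  import Data.Nat.Properties as ℕP
  open import Data.Fin using (Fin; toℕ)
  open import Data.Fin.Properties using () renaming (_<?_ to _<?ᶠ_)
  open import Data.List using (List; []; _∷_; concatMap; filterᵇ)
  open import Data.List.Relation.Unary.All using (All; []; _∷_)
  import Data.List.Relation.Unary.All.Properties as AllP
  open import Data.List.Membership.Propositional using (_∈_)
  open import Data.List.Relation.Unary.Any using (here; there)
  open import Data.Bool.ListAction using (any; all)
  open import Data.Product using (∃; _,_)
  open import Data.Sum using (_⊎_; inj₁; inj₂)
  open import Data.Empty using (⊥; ⊥-elim)
  open import Relation.Binary.PropositionalEquality using (_≡_; refl; sym)
  open import Relation.Nullary using (¬_; Dec; yes; no; does)
  open import Relation.Nullary.Decidable using (dec-true; dec-false)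

  witness : ∀ {p} {P : Set p} (d : Dec P) → does d ≡ true → P
  witness (yes x) _ = x
  witness (no _) ()

  t≢f : true ≡ false → ⊥
  t≢f ()

  ∧T₁ : ∀ {a b} → a ∧ b ≡ true → a ≡ true
  ∧T₁ {true} _ = refl
  ∧T₂ : ∀ {a b} → a ∧ b ≡ true → b ≡ true
  ∧T₂ {true} e = e
  T∧ : ∀ {a b} → a ≡ true → b ≡ true → a ∧ b ≡ true
  T∧ refl refl = refl
  F∧₁ : ∀ {a b} → a ≡ false → a ∧ b ≡ false
  F∧₁ refl = refl
  F∧₂ : ∀ {a b} → b ≡ false → a ∧ b ≡ false
  F∧₂ {true} e = e
  F∧₂ {false} _ = refl
  ∨T : ∀ {a b} → a ∨ b ≡ true → a ≡ true ⊎ b ≡ true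
  ∨T {true} _ = inj₁ refl
  ∨T {false} e = inj₂ e
  T∨₁ : ∀ {a b} → a ≡ true → a ∨ b ≡ true
  T∨₁ refl = refl
  T∨₂ : ∀ {a b} → b ≡ true → a ∨ b ≡ true
  T∨₂ {true} _ = refl
  T∨₂ {false} e = e
  ∨F∧ : ∀ {a f b} → a ∨ (f ∧ b) ≡ true → f ≡ false → a ≡ true
  ∨F∧ {true} _ _ = refl
  ∨F∧ {false} e refl = e
  notT : ∀ {a} → not a ≡ true → a ≡ false
  notT {false} _ = refl
  Tnot : ∀ {a} → a ≡ false → not a ≡ true
  Tnot refl = refl
  FT : ∀ {a} → a ≡ false → a ≡ true → ⊥
  FT refl ()
  ¬T : ∀ {a} → ¬ (a ≡ true) → a ≡ false
  ¬T {true} h = ⊥-elim (h refl)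
  ¬T {false} _ = refl
  ¬F : ∀ {a} → ¬ (a ≡ false) → a ≡ true
  ¬F {true} _ = refl
  ¬F {false} h = ⊥-elim (h refl)

  bool-ext : ∀ {a b} → (a ≡ true → b ≡ true) → (b ≡ true → a ≡ true) → a ≡ b
  bool-ext {true} {b} f g = sym (f refl)
  bool-ext {false} {true} f g = g refl
  bool-ext {false} {false} f g = refl

  anyT : ∀ {A : Set} (f : A → Bool) (xs : List A) → any f xs ≡ true → ∃ λ x → f x ≡ true
  anyT f (x ∷ xs) e with ∨T {f x} e
  ... | inj₁ h = x , h
  ... | inj₂ h = anyT f xs h

  Tany : ∀ {A : Set} (f : A → Bool) {xs : List A} {x} → x ∈ xs → f x ≡ true → any f xs ≡ true
  Tany f {x ∷ xs} (here refl) h = T∨₁ h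
  Tany f {y ∷ xs} (there m) h = T∨₂ {f y} (Tany f m h)

  allT : ∀ {A : Set} (f : A → Bool) (xs : List A) → all f xs ≡ true → ∀ {x} → x ∈ xs → f x ≡ true
  allT f (x ∷ xs) e (here refl) = ∧T₁ e
  allT f (y ∷ xs) e (there m) = allT f xs (∧T₂ {f y} e) m

  Tall : ∀ {A : Set} (f : A → Bool) (xs : List A) → (∀ {x} → x ∈ xs → f x ≡ true) → all f xs ≡ true
  Tall f [] h = refl
  Tall f (x ∷ xs) h = T∧ (h (here refl)) (Tall f xs (λ m → h (there m)))

  All-concatMap : ∀ {a b p} {A : Set a} {B : Set b} {Pr : B → Set p} (g : A → List B) (xs : List A) →
                  (∀ x → All Pr (g x)) → All Pr (concatMap g xs)
  All-concatMap g [] h = []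
  All-concatMap g (x ∷ xs) h = AllP.++⁺ (h x) (All-concatMap g xs h)

  All-filterᵇ : ∀ {a} {A : Set a} (q : A → Bool) (xs : List A) → All (λ x → q x ≡ true) (filterᵇ q xs)
  All-filterᵇ q [] = []
  All-filterᵇ q (x ∷ xs) with q x in eq
  ... | true = eq ∷ All-filterᵇ q xs
  ... | false = All-filterᵇ q xs

  ≡ᵇ-refl : ∀ n → (n ≡ᵇ n) ≡ true
  ≡ᵇ-refl n = Equivalence.to T-≡ (ℕP.≡⇒≡ᵇ n n refl)

  ≡ᵇ-T : ∀ m n → (m ≡ᵇ n) ≡ true → m ≡ n
  ≡ᵇ-T m n e = ℕP.≡ᵇ⇒≡ m n (Equivalence.from T-≡ e)

  ≡ᵇ-F : ∀ m n → ¬ (m ≡ n) → (m ≡ᵇ n) ≡ false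
  ≡ᵇ-F m n ne = ¬T (λ e → ne (≡ᵇ-T m n e))

  <ᴺ-T : ∀ m n → (m <ᴺ n) ≡ true → m ℕ.< n
  <ᴺ-T m n e = ℕP.<ᵇ⇒< m n (Equivalence.from T-≡ e)

  T-<ᴺ : ∀ {m n} → m ℕ.< n → (m <ᴺ n) ≡ true
  T-<ᴺ l = Equivalence.to T-≡ (ℕP.<⇒<ᵇ l)

  _<F_ : ∀ {n} → Fin n → Fin n → Set
  a <F b = toℕ a ℕ.< toℕ b

  <ᵇT : ∀ {n} {a b : Fin n} → (a <ᵇ b) ≡ true → a <F b
  <ᵇT {a = a} {b} e = witness (a <?ᶠ b) e
  T<ᵇ : ∀ {n} {a b : Fin n} → a <F b → (a <ᵇ b) ≡ true
  T<ᵇ {a = a} {b} p = dec-true (a <?ᶠ b) p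
  F<ᵇ : ∀ {n} {a b : Fin n} → ¬ (a <F b) → (a <ᵇ b) ≡ false
  F<ᵇ {a = a} {b} p = dec-false (a <?ᶠ b) p

  <F-irr : ∀ {n} {a : Fin n} → ¬ (a <F a)
  <F-irr = ℕP.<-irrefl refl
  <F-asym : ∀ {n} {a b : Fin n} → a <F b → ¬ (b <F a)
  <F-asym = ℕP.<-asym
  <F-trans : ∀ {n} {a b c : Fin n} → a <F b → b <F c → a <F c
  <F-trans = ℕP.<-trans
  <F≢ : ∀ {n} {a b : Fin n} → a <F b → a ≡ b → ⊥
  <F≢ p refl = <F-irr p

-- A path x = y₀ < y₁ < … < y_r = y (r ≥ 1) with
-- y_i ⊀ y_{i+1} in T is exactly a witness of  walk (edgeI T)  in Defs; a
-- path of length ≥ 2 is a witness of  chain (edgeI T).  We decode both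
-- Boolean searches into the inductive type Path, so that paths can be
-- manipulated structurally; in particular, path existence is decidable.
module Chains where

  open import Defs
  open Bookkeeping
  open import Data.Bool using (true; false; _∧_)
  open import Data.Nat as ℕ using (ℕ; zero; suc)
  import Data.Nat.Properties as ℕP
  open import Data.Fin using (Fin; toℕ)
  open import Data.Fin.Properties using (toℕ<n)
  open import Data.List using (allFin)
  open import Data.List.Membership.Propositional.Properties using (∈-allFin)
  open import Data.Product using (∃; _×_; _,_)
  open import Data.Sum using (_⊎_; inj₁; inj₂)
  open import Relation.Binary.PropositionalEquality using (_≡_; sym)
  open import Relation.Nullary using (¬_)

  data Path {n} (T : Rel n) : Fin n → Fin n → Set where
    one : ∀ {x y} → edgeI T x y ≡ true → Path T x y
    cns : ∀ {x b y} → edgeI T x b ≡ true → Path T b y → Path T x y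

  edge< : ∀ {n} {T : Rel n} {x y} → edgeI T x y ≡ true → x <F y
  edge< e = <ᵇT (∧T₁ e)
  edge¬ : ∀ {n} {T : Rel n} {x y} → edgeI T x y ≡ true → T x y ≡ false
  edge¬ {T = T} {x} {y} e = notT (∧T₂ {x <ᵇ y} e)
  mkEdge : ∀ {n} (T : Rel n) {x y} → x <F y → T x y ≡ false → edgeI T x y ≡ true
  mkEdge T p q = T∧ (T<ᵇ p) (Tnot q)

  path< : ∀ {n} {T : Rel n} {x y} → Path T x y → x <F y
  path< {T = T} (one e) = edge< {T = T} e
  path< {T = T} (cns e p) = <F-trans (edge< {T = T} e) (path< p)

  path-++ : ∀ {n} {T : Rel n} {x y z} → Path T x y → Path T y z → Path T x z
  path-++ (one e) q = cns e q
  path-++ (cns e p) q = cns e (path-++ p q)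

  len : ∀ {n} {T : Rel n} {x y} → Path T x y → ℕ
  len (one _) = 1
  len (cns _ p) = suc (len p)

  -- A path climbs at least one step per edge, so it has at most n edges.
  len-bound : ∀ {n} {T : Rel n} {x y} (p : Path T x y) → len p ℕ.+ toℕ x ℕ.≤ toℕ y
  len-bound {T = T} (one e) = edge< {T = T} e
  len-bound {T = T} {x = x} (cns e p) =
    ℕP.≤-trans (ℕP.≤-reflexive (sym (ℕP.+-suc (len p) (toℕ x))))
      (ℕP.≤-trans (ℕP.+-monoʳ-≤ (len p) (edge< {T = T} e)) (len-bound p))

  len≤n : ∀ {n} {T : Rel n} {x y} (p : Path T x y) → len p ℕ.≤ suc n
  len≤n {n} {x = x} {y} p =
    ℕP.≤-trans (ℕP.m≤m+n (len p) (toℕ x))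
      (ℕP.≤-trans (len-bound p) (ℕP.≤-trans (ℕP.<⇒≤ (toℕ<n y)) (ℕP.n≤1+n n)))

  walk-sound : ∀ {n} (T : Rel n) k {x y} → walk (edgeI T) k x y ≡ true → Path T x y
  walk-sound T zero e = one e
  walk-sound {n} T (suc k) {x} {y} e with ∨T {edgeI T x y} e
  ... | inj₁ h = one h
  ... | inj₂ h with anyT (λ b → edgeI T x b ∧ walk (edgeI T) k b y) (allFin n) h
  ... | b , h' = cns (∧T₁ h') (walk-sound T k (∧T₂ {edgeI T x b} h'))

  walk-complete : ∀ {n} (T : Rel n) {x y} (p : Path T x y) k → len p ℕ.≤ suc k →
                  walk (edgeI T) k x y ≡ true
  walk-complete T (one e) zero _ = e
  walk-complete T (one e) (suc k) _ = T∨₁ e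
  walk-complete T (cns e (one _)) zero (ℕ.s≤s ())
  walk-complete T (cns e (cns _ _)) zero (ℕ.s≤s ())
  walk-complete {n} T {x} {y} (cns {b = b} e p) (suc k) (ℕ.s≤s l) =
    T∨₂ {edgeI T x y} (Tany (λ b → edgeI T x b ∧ walk (edgeI T) k b y) (∈-allFin b)
          (T∧ e (walk-complete T p k l)))

  chainT : ∀ {n} (T : Rel n) {a c} → chain (edgeI T) a c ≡ true →
           ∃ λ b → edgeI T a b ≡ true × Path T b c
  chainT {n} T {a} {c} e with anyT (λ b → edgeI T a b ∧ walk (edgeI T) n b c) (allFin n) e
  ... | b , h = b , ∧T₁ h , walk-sound T n (∧T₂ {edgeI T a b} h)

  Tchain : ∀ {n} (T : Rel n) {a b c} → edgeI T a b ≡ true → Path T b c → chain (edgeI T) a c ≡ true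
  Tchain {n} T {a} {b} {c} e p =
    Tany (λ b → edgeI T a b ∧ walk (edgeI T) n b c) (∈-allFin b) (T∧ e (walk-complete T p n (len≤n p)))

  decPath : ∀ {n} (T : Rel n) x y → Path T x y ⊎ ¬ Path T x y
  decPath {n} T x y with walk (edgeI T) n x y in eq
  ... | true = inj₁ (walk-sound T n eq)
  ... | false = inj₂ (λ p → FT eq (walk-complete T p n (len≤n p)))

-- The linear extension e_I(T) of a poset T, described through paths:
--   x ⊲ y  ⇔  x = y,  or x < y with no path x → y,  or y < x with a path y → x.
-- From this description e_I(T) is a total order; e_D is then handled by
-- reversing T, since e_D(T) is the reverse of e_I of the reverse of T.
module LinearExtensions where

  open import Defs
  open Bookkeeping
  open Chains
  open import Data.Bool using (true; false; _∧_; _∨_; not)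
  open import Data.Bool.Properties using (∧-comm)
  open import Data.Nat using (zero; suc)
  open import Data.Fin using (Fin)
  open import Data.Fin.Properties using (<-cmp)
  open import Data.List using (List; []; _∷_; allFin)
  open import Data.Bool.ListAction using (any)
  open import Data.Product using (_×_; _,_)
  open import Data.Sum using (_⊎_; inj₁; inj₂; [_,_])
  import Data.Sum as Sum
  open import Data.Empty using (⊥-elim)
  open import Relation.Binary.PropositionalEquality using (_≡_; refl; sym; trans; cong; cong₂)
  open import Relation.Nullary using (¬_)
  open import Relation.Binary using (tri<; tri≈; tri>)

  _≗₂_ : ∀ {n} → Rel n → Rel n → Set
  A ≗₂ B = ∀ x y → A x y ≡ B x y

  module PosetFacts {n} (T : Rel n) (isP : IsPoset T) where
    open IsPoset isP

    -- A path a → c passes "around" every b strictly between a and c: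
    -- it yields a path a → b or a path b → c (by transitivity of T).
    cotrans : ∀ {a b c} → Path T a c → a <F b → b <F c → Path T a b ⊎ Path T b c
    cotrans {a} {b} {c} (one e) ab bc with T a b in eab
    ... | false = inj₁ (one (mkEdge T ab eab))
    ... | true with T b c in ebc
    ...   | false = inj₂ (one (mkEdge T bc ebc))
    ...   | true = ⊥-elim (FT (edge¬ {T = T} e) (transitive a b c eab ebc))
    cotrans {a} {b} {c} (cns {b = d} e p) ab bc with <-cmp b d
    ... | tri≈ _ refl _ = inj₁ (one e)
    ... | tri> _ _ db with cotrans p db bc
    ...   | inj₁ q = inj₁ (cns e q)
    ...   | inj₂ q = inj₂ q
    cotrans {a} {b} {c} (cns {b = d} e p) ab bc | tri< bd _ _ with T a b in eab
    ... | false = inj₁ (one (mkEdge T ab eab))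
    ... | true with T b d in ebd
    ...   | false = inj₂ (cns (mkEdge T bd ebd) p)
    ...   | true = ⊥-elim (FT (edge¬ {T = T} e) (transitive a b d eab ebd))

    dI⇒noPath : ∀ {x y} → x <F y → dI T x y ≡ true → ¬ Path T x y
    dI⇒noPath _ d (one e) = FT (edge¬ {T = T} e) (∧T₁ d)
    dI⇒noPath {x} {y} xy d (cns e p) = FT (notT (∧T₂ {T x y} d)) (T∧ (T<ᵇ xy) (Tchain T e p))

    noPath⇒dI : ∀ {x y} → x <F y → ¬ Path T x y → dI T x y ≡ true
    noPath⇒dI {x} {y} xy np = T∧ related (Tnot (F∧₂ noChain))
      where
      related : T x y ≡ true
      related = ¬F (λ f → np (one (mkEdge T xy f)))
      noChain : chain (edgeI T) x y ≡ false
      noChain = ¬T (λ c → let (b , e , p) = chainT T c in np (cns e p))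

    OrdI : Fin n → Fin n → Set
    OrdI x y = x ≡ y ⊎ (x <F y × ¬ Path T x y) ⊎ (y <F x × Path T y x)

    eI⇒ : ∀ x y → eI T x y ≡ true → OrdI x y
    eI⇒ x y e with <-cmp x y
    ... | tri≈ _ refl _ = inj₁ refl
    ... | tri< xy _ _ = inj₂ (inj₁ (xy , dI⇒noPath xy (∨F∧ e (F<ᵇ (<F-asym xy)))))
    ... | tri> _ _ yx = inj₂ (inj₂ (yx , pth))
      where
      pth : Path T y x
      pth with ∨T {dI T x y} e
      ... | inj₁ d = one (mkEdge T yx (¬T (λ t → <F≢ yx (sym (antisymmetric x y (∧T₁ d) t)))))
      ... | inj₂ h with decPath T y x
      ...   | inj₁ p = p
      ...   | inj₂ np = ⊥-elim (FT (notT (∧T₁ (∧T₂ {y <ᵇ x} h))) (noPath⇒dI yx np))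

    eI⇐ : ∀ x y → OrdI x y → eI T x y ≡ true
    eI⇐ x .x (inj₁ refl) = T∨₁ (T∧ (reflexive x) (Tnot (F∧₁ (F<ᵇ {a = x} {b = x} <F-irr))))
    eI⇐ x y (inj₂ (inj₁ (xy , np))) = T∨₁ (noPath⇒dI xy np)
    eI⇐ x y (inj₂ (inj₂ (yx , p))) with dI T x y in d
    ... | true = refl
    ... | false = T∧ (T<ᵇ yx) (T∧ (Tnot (¬T (λ t → dI⇒noPath yx t p))) refl)

    -- OrdI is a total order: transitivity uses cotrans and concatenation of paths.
    ord-trans : ∀ {x y z} → OrdI x y → OrdI y z → OrdI x z
    ord-trans (inj₁ refl) o = o
    ord-trans o (inj₁ refl) = o
    ord-trans (inj₂ (inj₁ (xy , nxy))) (inj₂ (inj₁ (yz , nyz))) =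
      inj₂ (inj₁ (<F-trans xy yz , λ p → [ nxy , nyz ] (cotrans p xy yz)))
    ord-trans {x} {y} {z} (inj₂ (inj₁ (xy , nxy))) (inj₂ (inj₂ (zy , pzy))) with <-cmp x z
    ... | tri≈ _ refl _ = inj₁ refl
    ... | tri< xz _ _ = inj₂ (inj₁ (xz , λ p → nxy (path-++ p pzy)))
    ... | tri> _ _ zx = inj₂ (inj₂ (zx , [ (λ q → q) , (λ q → ⊥-elim (nxy q)) ] (cotrans pzy zx xy)))
    ord-trans {x} {y} {z} (inj₂ (inj₂ (yx , pyx))) (inj₂ (inj₁ (yz , nyz))) with <-cmp x z
    ... | tri≈ _ refl _ = inj₁ refl
    ... | tri< xz _ _ = inj₂ (inj₁ (xz , λ p → nyz (path-++ pyx p)))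
    ... | tri> _ _ zx = inj₂ (inj₂ (zx , [ (λ q → ⊥-elim (nyz q)) , (λ q → q) ] (cotrans pyx yz zx)))
    ord-trans (inj₂ (inj₂ (yx , pyx))) (inj₂ (inj₂ (zy , pzy))) =
      inj₂ (inj₂ (<F-trans zy yx , path-++ pzy pyx))

    ord-antisym : ∀ {x y} → OrdI x y → OrdI y x → x ≡ y
    ord-antisym (inj₁ e) _ = e
    ord-antisym _ (inj₁ e) = sym e
    ord-antisym (inj₂ (inj₁ (xy , _))) (inj₂ (inj₁ (yx , _))) = ⊥-elim (<F-asym xy yx)
    ord-antisym (inj₂ (inj₁ (_ , n))) (inj₂ (inj₂ (_ , p))) = ⊥-elim (n p)
    ord-antisym (inj₂ (inj₂ (_ , p))) (inj₂ (inj₁ (_ , n))) = ⊥-elim (n p)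
    ord-antisym (inj₂ (inj₂ (yx , _))) (inj₂ (inj₂ (xy , _))) = ⊥-elim (<F-asym xy yx)

    ord-total : ∀ x y → OrdI x y ⊎ OrdI y x
    ord-total x y with <-cmp x y
    ... | tri≈ _ refl _ = inj₁ (inj₁ refl)
    ... | tri> _ _ yx with decPath T y x
    ...   | inj₁ p = inj₁ (inj₂ (inj₂ (yx , p)))
    ...   | inj₂ np = inj₂ (inj₂ (inj₁ (yx , np)))
    ord-total x y | tri< xy _ _ with decPath T x y
    ...   | inj₁ p = inj₂ (inj₂ (inj₂ (xy , p)))
    ...   | inj₂ np = inj₁ (inj₂ (inj₁ (xy , np)))

    eI-total : IsTotalOrder (eI T)
    eI-total = record
      { isPoset = record
        { reflexive = λ a → eI⇐ a a (inj₁ refl)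
        ; antisymmetric = λ a b p q → ord-antisym (eI⇒ a b p) (eI⇒ b a q)
        ; transitive = λ a b c p q → eI⇐ a c (ord-trans (eI⇒ a b p) (eI⇒ b c q)) }
      ; total = λ a b → Sum.map (eI⇐ a b) (eI⇐ b a) (ord-total a b) }

  flipR : ∀ {n} → Rel n → Rel n
  flipR T x y = T y x

  flip-poset : ∀ {n} {T : Rel n} → IsPoset T → IsPoset (flipR T)
  flip-poset isP = record
    { reflexive = reflexive
    ; antisymmetric = λ a b p q → antisymmetric a b q p
    ; transitive = λ a b c p q → transitive c b a q p }
    where open IsPoset isP

  flip-total : ∀ {n} {T : Rel n} → IsTotalOrder T → IsTotalOrder (flipR T)
  flip-total t = record { isPoset = flip-poset (IsTotalOrder.isPoset t)
                        ; total = λ a b → IsTotalOrder.total t b a }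

  eD≡ : ∀ {n} (T : Rel n) x y → eD T x y ≡ eI (flipR T) y x
  eD≡ T x y = cong (λ z → dI (flipR T) y x ∨ ((x <ᵇ y) ∧ z))
                 (∧-comm (not (dI (flipR T) y x)) (not (dI (flipR T) x y)))

  poset-resp : ∀ {n} {A B : Rel n} → A ≗₂ B → IsPoset A → IsPoset B
  poset-resp {A = A} {B} eq t = record
      { reflexive = λ a → trans (sym (eq a a)) (reflexive a)
      ; antisymmetric = λ a b p q → antisymmetric a b (trans (eq a b) p) (trans (eq b a) q)
      ; transitive = λ a b c p q → trans (sym (eq a c)) (transitive a b c (trans (eq a b) p) (trans (eq b c) q)) }
    where open IsPoset t

  total-resp : ∀ {n} {A B : Rel n} → A ≗₂ B → IsTotalOrder A → IsTotalOrder B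
  total-resp eq t = record
    { isPoset = poset-resp eq (IsTotalOrder.isPoset t)
    ; total = λ a b → Sum.map (λ p → trans (sym (eq a b)) p) (λ p → trans (sym (eq b a)) p) (IsTotalOrder.total t a b) }

  eI-total : ∀ {n} (T : Rel n) → IsPoset T → IsTotalOrder (eI T)
  eI-total T isP = PosetFacts.eI-total T isP

  eD-total : ∀ {n} (T : Rel n) → IsPoset T → IsTotalOrder (eD T)
  eD-total T isP = total-resp (λ x y → sym (eD≡ T x y))
                     (flip-total (PosetFacts.eI-total (flipR T) (flip-poset isP)))

  any-cong : ∀ {A : Set} (f g : A → _) (xs : List A) → (∀ x → f x ≡ g x) → any f xs ≡ any g xs
  any-cong f g [] h = refl
  any-cong f g (x ∷ xs) h = cong₂ _∨_ (h x) (any-cong f g xs h)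

  walk-cong : ∀ {n} (E E' : Fin n → Fin n → _) → E ≗₂ E' → ∀ k x y → walk E k x y ≡ walk E' k x y
  walk-cong E E' h zero x y = h x y
  walk-cong {n} E E' h (suc k) x y = cong₂ _∨_ (h x y)
    (any-cong _ _ (allFin n) (λ b → cong₂ _∧_ (h x b) (walk-cong E E' h k b y)))

  dI-cong : ∀ {n} (T T' : Rel n) → T ≗₂ T' → dI T ≗₂ dI T'
  dI-cong {n} T T' h x y = cong₂ _∧_ (h x y) (cong (λ z → not ((x <ᵇ y) ∧ z))
     (any-cong _ _ (allFin n) (λ b → cong₂ _∧_ (edge {x} b) (walk-cong _ _ (λ a c → edge {a} c) n b y))))
    where
    edge : ∀ {a} b → edgeI T a b ≡ edgeI T' a b
    edge {a} b = cong (λ z → (a <ᵇ b) ∧ not z) (h a b)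

  eI-cong : ∀ {n} (T T' : Rel n) → T ≗₂ T' → eI T ≗₂ eI T'
  eI-cong T T' h x y rewrite dI-cong T T' h x y | dI-cong T T' h y x = refl

  eD-cong : ∀ {n} (T T' : Rel n) → T ≗₂ T' → eD T ≗₂ eD T'
  eD-cong T T' h x y =
    trans (eD≡ T x y) (trans (eI-cong (flipR T) (flipR T') (λ a b → h b a) y x) (sym (eD≡ T' x y)))

-- The restricted
-- relation S(i,j) = T(f i, f j) has as paths exactly the paths of T between
-- image points, provided the image is closed under the relevant path steps;
-- then e_I(S) is the restriction of e_I(T).  Intervals [m] and [n]‾ inside
-- [m+n] are such closed images.
module Restrictions where

  open import Defs
  open Bookkeeping
  open Chains
  open LinearExtensions
  open import Data.Bool using (true; _∧_; not)
  open import Data.Nat as ℕ using (ℕ; _+_)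
  import Data.Nat.Properties as ℕP
  open import Data.Fin using (Fin; toℕ; _↑ˡ_; _↑ʳ_; splitAt)
  open import Data.Fin.Properties using (<-cmp; toℕ-↑ˡ; toℕ-↑ʳ; toℕ<n; splitAt⁻¹-↑ˡ; splitAt⁻¹-↑ʳ)
  open import Data.Product using (∃; _,_)
  open import Data.Sum using (inj₁; inj₂)
  open import Data.Empty using (⊥-elim)
  open import Relation.Binary.PropositionalEquality using (_≡_; refl; sym; trans; cong; subst)
  open import Relation.Binary using (tri<; tri≈; tri>)

  module Restrict {k n} (T : Rel n) (f : Fin k → Fin n)
                  (mono : ∀ {i j} → i <F j → f i <F f j) where
    S : Rel k
    S i j = T (f i) (f j)

    refl< : ∀ {i j} → f i <F f j → i <F j
    refl< {i} {j} p with <-cmp i j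
    ... | tri< a _ _ = a
    ... | tri≈ _ refl _ = ⊥-elim (<F-irr p)
    ... | tri> _ _ c = ⊥-elim (<F-asym p (mono c))

    inj : ∀ {i j} → f i ≡ f j → i ≡ j
    inj {i} {j} e with <-cmp i j
    ... | tri< a _ _ = ⊥-elim (<F≢ (mono a) e)
    ... | tri≈ _ q _ = q
    ... | tri> _ _ c = ⊥-elim (<F≢ (mono c) (sym e))

    -- f preserves and reflects the natural order, hence the path edges.
    edge-eq : ∀ i j → edgeI S i j ≡ edgeI T (f i) (f j)
    edge-eq i j = cong (λ z → z ∧ not (T (f i) (f j)))
                    (bool-ext (λ e → T<ᵇ (mono (<ᵇT e))) (λ e → T<ᵇ (refl< (<ᵇT e))))

    down : ∀ {i j} → Path S i j → Path T (f i) (f j)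
    down {i} {j} (one e) = one (trans (sym (edge-eq i j)) e)
    down {i} {j} (cns {b = b} e p) = cns (trans (sym (edge-eq i b)) e) (down p)

    Closed : Set
    Closed = ∀ i j b → edgeI T (f i) b ≡ true → Path T b (f j) → ∃ λ k → f k ≡ b

    up : Closed → ∀ {x y} → Path T x y → ∀ i j → f i ≡ x → f j ≡ y → Path S i j
    up cl (one e) i j refl refl = one (trans (edge-eq i j) e)
    up cl (cns {b = b} e p) i j refl refl with cl i j b e p
    ... | c , refl = cns (trans (edge-eq i c) e) (up cl p c j refl refl)

    closedFwd : (∀ i b → edgeI T (f i) b ≡ true → ∃ λ k → f k ≡ b) → Closed
    closedFwd h i j b e _ = h i b e

    closedBwd : (∀ j b → edgeI T b (f j) ≡ true → ∃ λ k → f k ≡ b) → Closed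
    closedBwd h i j b e p = go p j refl
      where
      go : ∀ {c y} → Path T c y → ∀ j → f j ≡ y → ∃ λ k → f k ≡ c
      go (one e) j refl = h j _ e
      go (cns e p) j q with go p j q
      ... | k , refl = h k _ e

    S-poset : IsPoset T → IsPoset S
    S-poset isP = record
      { reflexive = λ a → reflexive (f a)
      ; antisymmetric = λ a b p q → inj (antisymmetric (f a) (f b) p q)
      ; transitive = λ a b c p q → transitive (f a) (f b) (f c) p q }
      where open IsPoset isP

    eI-restr : IsPoset T → Closed → ∀ i j → eI S i j ≡ eI T (f i) (f j)
    eI-restr isP cl i j = bool-ext fw bw
      where
      module PS = PosetFacts S (S-poset isP)
      module PT = PosetFacts T isP
      fw : eI S i j ≡ true → eI T (f i) (f j) ≡ true
      fw e with PS.eI⇒ i j e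
      ... | inj₁ refl = PT.eI⇐ _ _ (inj₁ refl)
      ... | inj₂ (inj₁ (ij , np)) = PT.eI⇐ _ _ (inj₂ (inj₁ (mono ij , λ p → np (up cl p i j refl refl))))
      ... | inj₂ (inj₂ (ji , p)) = PT.eI⇐ _ _ (inj₂ (inj₂ (mono ji , down p)))
      bw : eI T (f i) (f j) ≡ true → eI S i j ≡ true
      bw e with PT.eI⇒ _ _ e
      ... | inj₁ q = PS.eI⇐ _ _ (inj₁ (inj q))
      ... | inj₂ (inj₁ (ij , np)) = PS.eI⇐ _ _ (inj₂ (inj₁ (refl< ij , λ p → np (down p))))
      ... | inj₂ (inj₂ (ji , p)) = PS.eI⇐ _ _ (inj₂ (inj₂ (refl< ji , up cl p j i refl refl)))

  eD-restr : ∀ {k n} (T : Rel n) (f : Fin k → Fin n) (mono : ∀ {i j} → i <F j → f i <F f j) →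
             IsPoset T → Restrict.Closed (flipR T) f mono → ∀ i j →
             eD (Restrict.S T f mono) i j ≡ eD T (f i) (f j)
  eD-restr T f mono isP cl i j =
    trans (eD≡ (Restrict.S T f mono) i j)
     (trans (Restrict.eI-restr (flipR T) f mono (flip-poset isP) cl j i) (sym (eD≡ T (f i) (f j))))

  module _ {m n : ℕ} where
    monoL : ∀ {i j : Fin m} → i <F j → (i ↑ˡ n) <F (j ↑ˡ n)
    monoL {i} {j} p rewrite toℕ-↑ˡ i n | toℕ-↑ˡ j n = p

    monoR : ∀ {i j : Fin n} → i <F j → (m ↑ʳ i) <F (m ↑ʳ j)
    monoR {i} {j} p rewrite toℕ-↑ʳ m i | toℕ-↑ʳ m j = ℕP.+-monoʳ-< m p

    -- A path ending in [m] lies in [m]: paths increase.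
    closedL : (Q : Rel (m + n)) → Restrict.Closed Q (λ i → i ↑ˡ n) monoL
    closedL Q i j b e p with splitAt m b in eq
    ... | inj₁ c = c , splitAt⁻¹-↑ˡ eq
    ... | inj₂ c = ⊥-elim (ℕP.<-irrefl refl (ℕP.<-≤-trans (ℕP.<-trans bj (toℕ<n j)) ge))
      where
      bj : toℕ b ℕ.< toℕ j
      bj = subst (λ z → toℕ b ℕ.< z) (toℕ-↑ˡ j n) (path< p)
      ge : m ℕ.≤ toℕ b
      ge = subst (λ z → m ℕ.≤ toℕ z) (splitAt⁻¹-↑ʳ eq) (subst (m ℕ.≤_) (sym (toℕ-↑ʳ m c)) (ℕP.m≤m+n m (toℕ c)))

    closedR : (Q : Rel (m + n)) → Restrict.Closed Q (λ i → m ↑ʳ i) monoR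
    closedR Q i j b e p with splitAt m b in eq
    ... | inj₂ c = c , splitAt⁻¹-↑ʳ eq
    ... | inj₁ c = ⊥-elim (ℕP.<-irrefl refl (ℕP.<-≤-trans (ℕP.<-≤-trans bm ge) (ℕP.<⇒≤ ib)))
      where
      ib : toℕ (m ↑ʳ i) ℕ.< toℕ b
      ib = edge< {T = Q} e
      bm : toℕ b ℕ.< m
      bm = subst (λ z → toℕ z ℕ.< m) (splitAt⁻¹-↑ˡ eq) (subst (ℕ._< m) (sym (toℕ-↑ˡ c n)) (toℕ<n c))
      ge : m ℕ.≤ toℕ (m ↑ʳ i)
      ge = subst (m ℕ.≤_) (sym (toℕ-↑ʳ m i)) (ℕP.m≤m+n m (toℕ i))

-- The list  elems X  is strictly increasing,
-- so  lookup (elems X)  is a strictly increasing enumeration of X and the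
-- restriction T_X of Defs is a restriction in the sense of Restrictions.
-- A total cut (X, Y) of a poset T is a total cut of e(T), and e commutes
-- with restriction to X and to Y: paths cannot leave X, nor enter Y.
module Cuts where

  open import Defs
  open Bookkeeping
  open Chains
  open LinearExtensions
  open Restrictions
  open import Data.Bool using (Bool; true; false; _∧_; _∨_; not)
  open import Data.Bool.Properties using (not-involutive)
  open import Data.Nat as ℕ using (ℕ; zero; suc)
  open import Data.Fin as Fin using (Fin)
  open import Data.Fin.Properties using (<-cmp)
  open import Data.List using (List; []; _∷_; allFin; length; lookup; filterᵇ; tabulate)
  open import Data.List.Relation.Unary.All as All using (All; []; _∷_)
  import Data.List.Relation.Unary.All.Properties as AllP
  open import Data.List.Membership.Propositional using (_∈_)
  open import Data.List.Membership.Propositional.Properties using (∈-allFin; ∈-lookup)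
  open import Data.List.Relation.Unary.Any using (here; there)
  open import Data.Product using (Σ; _×_; _,_; proj₁; proj₂)
  open import Data.Sum using (inj₁; inj₂)
  open import Data.Empty using (⊥-elim)
  open import Data.Unit using (⊤; tt)
  open import Relation.Binary.PropositionalEquality using (_≡_; refl; sym; trans; cong; subst)
  open import Relation.Binary using (tri<; tri≈; tri>)

  Sorted : ∀ {p} → List (Fin p) → Set
  Sorted [] = ⊤
  Sorted (x ∷ xs) = All (x <F_) xs × Sorted xs

  lookup-mono : ∀ {p} (xs : List (Fin p)) → Sorted xs → ∀ {i j} → i <F j → lookup xs i <F lookup xs j
  lookup-mono (x ∷ xs) (a , s) {Fin.zero} {Fin.suc j} _ = All.lookup a (∈-lookup j)
  lookup-mono (x ∷ xs) (a , s) {Fin.suc i} {Fin.suc j} (ℕ.s≤s lt) = lookup-mono xs s lt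

  sorted-tabulate : ∀ {p k} (f : Fin k → Fin p) → (∀ {i j} → i <F j → f i <F f j) → Sorted (tabulate f)
  sorted-tabulate {k = zero} f m = tt
  sorted-tabulate {k = suc k} f m =
    AllP.tabulate⁺ (λ i → m {Fin.zero} {Fin.suc i} (ℕ.s≤s ℕ.z≤n)) ,
    sorted-tabulate (λ i → f (Fin.suc i)) (λ lt → m (ℕ.s≤s lt))

  all-filter : ∀ {A : Set} {P : A → Set} (Z : A → Bool) (xs : List A) → All P xs → All P (filterᵇ Z xs)
  all-filter Z [] [] = []
  all-filter Z (x ∷ xs) (px ∷ a) with Z x
  ... | true = px ∷ all-filter Z xs a
  ... | false = all-filter Z xs a

  sorted-filter : ∀ {p} (Z : Fin p → Bool) (xs : List (Fin p)) → Sorted xs → Sorted (filterᵇ Z xs)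
  sorted-filter Z [] s = tt
  sorted-filter Z (x ∷ xs) (a , s) with Z x
  ... | true = all-filter Z xs a , sorted-filter Z xs s
  ... | false = sorted-filter Z xs s

  lookup-filter : ∀ {A : Set} (Z : A → Bool) (xs : List A) i → Z (lookup (filterᵇ Z xs) i) ≡ true
  lookup-filter Z (x ∷ xs) i with Z x in eq
  lookup-filter Z (x ∷ xs) Fin.zero | true = eq
  lookup-filter Z (x ∷ xs) (Fin.suc i) | true = lookup-filter Z xs i
  ... | false = lookup-filter Z xs i

  index-filter : ∀ {A : Set} (Z : A → Bool) (xs : List A) z → z ∈ xs → Z z ≡ true →
                 Σ (Fin (length (filterᵇ Z xs))) λ i → lookup (filterᵇ Z xs) i ≡ z
  index-filter Z (x ∷ xs) z (here refl) h with Z x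
  ... | true = Fin.zero , refl
  index-filter Z (x ∷ xs) z (here refl) () | false
  index-filter Z (x ∷ xs) z (there m) h with Z x
  ... | true = let (i , e) = index-filter Z xs z m h in Fin.suc i , e
  ... | false = index-filter Z xs z m h

  module Elems {p} (Z : Fin p → Bool) where
    fz : Fin (length (elems Z)) → Fin p
    fz = lookup (elems Z)
    monoZ : ∀ {i j} → i <F j → fz i <F fz j
    monoZ = lookup-mono (elems Z) (sorted-filter Z (allFin p) (sorted-tabulate (λ i → i) (λ lt → lt)))
    inZ : ∀ i → Z (fz i) ≡ true
    inZ = lookup-filter Z (allFin p)
    preZ : ∀ z → Z z ≡ true → Σ (Fin (length (elems Z))) λ i → fz i ≡ z
    preZ z h = index-filter Z (allFin p) z (∈-allFin z) h
    injZ : ∀ {i j} → fz i ≡ fz j → i ≡ j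
    injZ = Restrict.inj (λ _ _ → true) fz monoZ

  Cut : ∀ {p} → Rel p → (Fin p → Bool) → Set
  Cut T X = ∀ x y → X x ≡ true → X y ≡ false → T x y ≡ true × T y x ≡ false

  cutT : ∀ {p} (T : Rel p) X → totalCutᵇ T X ≡ true → Cut T X
  cutT {p} T X e x y hx hy with allT _ (allFin p) (allT _ (allFin p) e (∈-allFin x)) (∈-allFin y)
  ... | h rewrite hx | hy = ∧T₁ h , notT (∧T₂ {T x y} h)

  Tcut : ∀ {p} (T : Rel p) X → Cut T X → totalCutᵇ T X ≡ true
  Tcut {p} T X c = Tall _ (allFin p) (λ {x} _ → Tall _ (allFin p) (λ {y} _ → go x y))
    where
    go : ∀ x y → (not (X x ∧ not (X y)) ∨ (T x y ∧ not (T y x))) ≡ true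
    go x y with X x in hx | X y in hy
    ... | false | _ = refl
    ... | true | true = refl
    ... | true | false = T∨₂ {false} (T∧ (proj₁ (c x y hx hy)) (Tnot (proj₂ (c x y hx hy))))

  module CutI {p} (T : Rel p) (isP : IsPoset T) (X : Fin p → Bool) (c : Cut T X) where
    module PT = PosetFacts T isP

    fwd : ∀ {x b} → edgeI T x b ≡ true → X x ≡ true → X b ≡ true
    fwd {x} {b} e hx = ¬F (λ hb → FT (edge¬ {T = T} e) (proj₁ (c x b hx hb)))
    bwd : ∀ {b y} → edgeI T b y ≡ true → X y ≡ false → X b ≡ false
    bwd {b} {y} e hy = ¬T (λ hb → FT (edge¬ {T = T} e) (proj₁ (c b y hb hy)))
    fwdP : ∀ {x y} → Path T x y → X x ≡ true → X y ≡ true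
    fwdP (one e) h = fwd e h
    fwdP (cns e q) h = fwdP q (fwd e h)

    -- X is below its complement in e_I(T) too: forward pairs are linked by no
    -- path (paths cannot leave X) and backward pairs are path edges.
    cutE : Cut (eI T) X
    cutE x y hx hy = xy , yx
      where
      xy : eI T x y ≡ true
      xy with <-cmp x y
      ... | tri≈ _ refl _ = ⊥-elim (FT hy hx)
      ... | tri< a _ _ = PT.eI⇐ x y (inj₂ (inj₁ (a , λ q → FT hy (fwdP q hx))))
      ... | tri> _ _ b = PT.eI⇐ x y (inj₂ (inj₂ (b , one (mkEdge T b (proj₂ (c x y hx hy))))))
      yx : eI T y x ≡ false
      yx = ¬T (λ t → FT hy (subst (λ z → X z ≡ true)
              (IsPoset.antisymmetric (IsTotalOrder.isPoset (eI-total T isP)) x y xy t) hx))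

    restrX : ∀ (Z : Fin p → Bool) → (∀ z → Z z ≡ X z) → ∀ i j →
             eI (proj₂ (restrict T Z)) i j ≡ proj₂ (restrict (eI T) Z) i j
    restrX Z zx = Restrict.eI-restr T fz monoZ isP
        (Restrict.closedFwd T fz monoZ (λ i b e → preZ b (trans (zx b) (fwd e (trans (sym (zx (fz i))) (inZ i))))))
      where open Elems Z

    restrY : ∀ (Z : Fin p → Bool) → (∀ z → Z z ≡ not (X z)) → ∀ i j →
             eI (proj₂ (restrict T Z)) i j ≡ proj₂ (restrict (eI T) Z) i j
    restrY Z zy = Restrict.eI-restr T fz monoZ isP
        (Restrict.closedBwd T fz monoZ (λ j b e → preZ b (trans (zy b) (Tnot (bwd e (notT (trans (sym (zy (fz j))) (inZ j))))))))
      where open Elems Z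

  -- For e_D: the complement of X is a total cut of the reversed relation.
  module CutD {p} (T : Rel p) (isP : IsPoset T) (X : Fin p → Bool) (c : Cut T X) where
    Y : Fin p → Bool
    Y z = not (X z)
    flipCut : Cut (flipR T) Y
    flipCut y x hy hx = c x y (trans (sym (not-involutive (X x))) (cong not hx)) (notT hy)
    module CF = CutI (flipR T) (flip-poset isP) Y flipCut
    cutE : Cut (eD T) X
    cutE x y hx hy = trans (eD≡ T x y) (proj₁ (CF.cutE y x (Tnot hy) (cong not hx))) ,
                     trans (eD≡ T y x) (proj₂ (CF.cutE y x (Tnot hy) (cong not hx)))
    restrX : ∀ i j → eD (proj₂ (restrict T X)) i j ≡ proj₂ (restrict (eD T) X) i j
    restrX i j = trans (eD≡ _ i j)
      (trans (CF.restrY X (λ z → sym (not-involutive (X z))) j i) (sym (eD≡ T _ _)))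
    restrY : ∀ i j → eD (proj₂ (restrict T Y)) i j ≡ proj₂ (restrict (eD T) Y) i j
    restrY i j = trans (eD≡ _ i j) (trans (CF.restrX Y (λ _ → refl) j i) (sym (eD≡ T _ _)))

module Admissibility where

  open import Defs
  open LinearExtensions
  open Restrictions
  open Cuts
  open import Data.Bool using (not)
  open import Data.Nat using (_+_)
  open import Data.Fin using (_↑ˡ_; _↑ʳ_)
  open import Data.Product using (proj₂)
  open import Relation.Binary.PropositionalEquality using (_≡_; refl)

  record Admissible (e : ∀ {n} → Rel n → Rel n) : Set where
    field
      tot : ∀ {n} (T : Rel n) → IsPoset T → IsTotalOrder (e T)
      resp : ∀ {n} (T T' : Rel n) → T ≗₂ T' → e T ≗₂ e T'
      restrL : ∀ {m n} (T : Rel (m + n)) → IsPoset T → ∀ i j →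
               e (λ a b → T (a ↑ˡ n) (b ↑ˡ n)) i j ≡ e T (i ↑ˡ n) (j ↑ˡ n)
      restrR : ∀ {m n} (T : Rel (m + n)) → IsPoset T → ∀ i j →
               e (λ a b → T (m ↑ʳ a) (m ↑ʳ b)) i j ≡ e T (m ↑ʳ i) (m ↑ʳ j)
      cutE : ∀ {p} (T : Rel p) → IsPoset T → ∀ X → Cut T X → Cut (e T) X
      cutX : ∀ {p} (T : Rel p) → IsPoset T → ∀ X → Cut T X → ∀ i j →
             e (proj₂ (restrict T X)) i j ≡ proj₂ (restrict (e T) X) i j
      cutY : ∀ {p} (T : Rel p) → IsPoset T → ∀ X → Cut T X → ∀ i j →
             e (proj₂ (restrict T (λ x → not (X x)))) i j ≡ proj₂ (restrict (e T) (λ x → not (X x))) i j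

  eI-admissible : Admissible eI
  eI-admissible = record
    { tot = eI-total
    ; resp = eI-cong
    ; restrL = λ {m} {n} T isP → Restrict.eI-restr T (λ i → i ↑ˡ n) monoL isP (closedL T)
    ; restrR = λ {m} {n} T isP → Restrict.eI-restr T (λ i → m ↑ʳ i) monoR isP (closedR T)
    ; cutE = CutI.cutE
    ; cutX = λ T isP X c → CutI.restrX T isP X c X (λ _ → refl)
    ; cutY = λ T isP X c → CutI.restrY T isP X c _ (λ _ → refl) }

  eD-admissible : Admissible eD
  eD-admissible = record
    { tot = eD-total
    ; resp = eD-cong
    ; restrL = λ {m} {n} T isP → eD-restr T (λ i → i ↑ˡ n) monoL isP (closedL (flipR T))
    ; restrR = λ {m} {n} T isP → eD-restr T (λ i → m ↑ʳ i) monoR isP (closedR (flipR T))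
    ; cutE = CutD.cutE
    ; cutX = CutD.restrX
    ; cutY = CutD.restrY }

module FiniteSums {c ℓ} (K : CommutativeRing c ℓ) where

  open import Data.Bool using (Bool; true; false; _∧_; if_then_else_)
  open import Data.List using (List; []; _∷_; _++_; map; concatMap; filterᵇ)
  open import Relation.Binary.PropositionalEquality as P using (_≡_)
  open CommutativeRing K renaming (Carrier to 𝕂)
  open import Algebra.Properties.CommutativeSemigroup *-commutativeSemigroup
    using (x∙yz≈y∙xz; interchange) public
  open import Relation.Binary.Reasoning.Setoid setoid public

  ≡⇒≈ : ∀ {x y : 𝕂} → x ≡ y → x ≈ y
  ≡⇒≈ P.refl = refl

  ⟦_⟧ : Bool → 𝕂
  ⟦ true ⟧ = 1#
  ⟦ false ⟧ = 0#

  ⟦∧⟧ : ∀ a b → ⟦ a ∧ b ⟧ ≈ ⟦ a ⟧ * ⟦ b ⟧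
  ⟦∧⟧ true b = sym (*-identityˡ _)
  ⟦∧⟧ false b = sym (zeroˡ _)

  ⟦≡⟧ : ∀ {a b} → a ≡ b → ⟦ a ⟧ ≈ ⟦ b ⟧
  ⟦≡⟧ P.refl = refl

  ⟦⟧-guarded : ∀ a a' b → (b ≡ true → a ≡ a') → ⟦ a ⟧ * ⟦ b ⟧ ≈ ⟦ a' ⟧ * ⟦ b ⟧
  ⟦⟧-guarded a a' true h = *-congʳ (⟦≡⟧ (h P.refl))
  ⟦⟧-guarded a a' false h = trans (zeroʳ _) (sym (zeroʳ _))

  sumL : ∀ {a} {A : Set a} → List A → (A → 𝕂) → 𝕂
  sumL [] f = 0#
  sumL (x ∷ xs) f = f x + sumL xs f

  module _ {a} {A : Set a} where
    sumL-cong : ∀ (xs : List A) {f g : A → 𝕂} → (∀ x → f x ≈ g x) → sumL xs f ≈ sumL xs g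
    sumL-cong [] h = refl
    sumL-cong (x ∷ xs) h = +-cong (h x) (sumL-cong xs h)

    sumL-++ : ∀ (xs ys : List A) f → sumL (xs ++ ys) f ≈ sumL xs f + sumL ys f
    sumL-++ [] ys f = sym (+-identityˡ _)
    sumL-++ (x ∷ xs) ys f = trans (+-congˡ (sumL-++ xs ys f)) (sym (+-assoc _ _ _))

    sumL-0 : ∀ (xs : List A) {f} → (∀ x → f x ≈ 0#) → sumL xs f ≈ 0#
    sumL-0 [] h = refl
    sumL-0 (x ∷ xs) h = trans (+-cong (h x) (sumL-0 xs h)) (+-identityˡ _)

    sumL-*ˡ : ∀ (xs : List A) a f → a * sumL xs f ≈ sumL xs (λ x → a * f x)
    sumL-*ˡ [] a f = zeroʳ a
    sumL-*ˡ (x ∷ xs) a f = trans (distribˡ a _ _) (+-congˡ (sumL-*ˡ xs a f))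

    sumL-+ : ∀ (xs : List A) f g → sumL xs (λ x → f x + g x) ≈ sumL xs f + sumL xs g
    sumL-+ [] f g = sym (+-identityˡ _)
    sumL-+ (x ∷ xs) f g = trans (+-congˡ (sumL-+ xs f g)) (+-interchange _ _ _ _)
      where open import Algebra.Properties.CommutativeSemigroup +-commutativeSemigroup
              using () renaming (interchange to +-interchange)

    sumL-filter : ∀ (p : A → Bool) (xs : List A) f → sumL (filterᵇ p xs) f ≈ sumL xs (λ x → ⟦ p x ⟧ * f x)
    sumL-filter p [] f = refl
    sumL-filter p (x ∷ xs) f with p x
    ... | true = +-cong (sym (*-identityˡ _)) (sumL-filter p xs f)
    ... | false = trans (sumL-filter p xs f) (trans (sym (+-identityˡ _)) (+-congʳ (sym (zeroˡ _))))

    sumL-if : ∀ (b : Bool) (u : A) f → sumL (if b then u ∷ [] else []) f ≈ ⟦ b ⟧ * f u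
    sumL-if true u f = trans (+-identityʳ _) (sym (*-identityˡ _))
    sumL-if false u f = sym (zeroˡ _)

  module _ {a b} {A : Set a} {B : Set b} where
    sumL-map : ∀ (g : A → B) (xs : List A) f → sumL (map g xs) f ≈ sumL xs (λ x → f (g x))
    sumL-map g [] f = refl
    sumL-map g (x ∷ xs) f = +-congˡ (sumL-map g xs f)

    sumL-concatMap : ∀ (g : A → List B) (xs : List A) f → sumL (concatMap g xs) f ≈ sumL xs (λ x → sumL (g x) f)
    sumL-concatMap g [] f = refl
    sumL-concatMap g (x ∷ xs) f = trans (sumL-++ (g x) (concatMap g xs) f) (+-congˡ (sumL-concatMap g xs f))

    sumL-swap : ∀ (xs : List A) (ys : List B) (f : A → B → 𝕂) →
                sumL xs (λ x → sumL ys (λ y → f x y)) ≈ sumL ys (λ y → sumL xs (λ x → f x y))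
    sumL-swap [] ys f = sym (sumL-0 ys (λ _ → refl))
    sumL-swap (x ∷ xs) ys f = trans (+-congˡ (sumL-swap xs ys f)) (sym (sumL-+ ys (f x) _))

-- Boolean equality of relations.  eqR is equality of relations defined by
-- recursion on the size, which is what the enumeration lemmas below need;
-- sameᵇ of Defs (sizes and values agree) reduces to it.
module DecidableRelations where

  open import Defs
  open Bookkeeping
  open LinearExtensions using (_≗₂_; poset-resp; total-resp)
  open import Data.Bool using (Bool; true; false; _∧_)
  open import Data.Bool.Properties using () renaming (_≟_ to _≟ᵇ_)
  open import Data.Nat as ℕ using (ℕ; zero; suc)
  open import Data.Fin as Fin using (Fin)
  open import Data.Fin.Properties using (all?)
  open import Data.List using (List)
  open import Data.List.Membership.Propositional using (_∈_)
  open import Data.List.Membership.Propositional.Properties using (∈-map⁺; ∈-concatMap⁺)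
  import Data.List.Relation.Unary.Any as Any
  open import Data.List.Relation.Unary.Any using (here; there)
  open import Data.Product using (∃; _×_; _,_; proj₂)
  open import Data.Empty using (⊥-elim)
  open import Data.Sum using (_⊎_)
  open import Relation.Nullary using (¬_; Dec; yes; no; does)
  open import Relation.Nullary.Decidable using (dec-true; _⊎-dec_)
  open import Relation.Binary.PropositionalEquality as P using (_≡_)

  eqB : Bool → Bool → Bool
  eqB true true = true
  eqB false false = true
  eqB _ _ = false

  eqB-T : ∀ {a b} → eqB a b ≡ true → a ≡ b
  eqB-T {true} {true} _ = P.refl
  eqB-T {false} {false} _ = P.refl

  T-eqB : ∀ {a b} → a ≡ b → eqB a b ≡ true
  T-eqB {true} P.refl = P.refl
  T-eqB {false} P.refl = P.refl

  eqFb : ∀ {k} {A : Set} → (A → A → Bool) → (Fin k → A) → (Fin k → A) → Bool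
  eqFb {zero} eqA f g = true
  eqFb {suc k} eqA f g = eqA (f Fin.zero) (g Fin.zero) ∧ eqFb eqA (λ i → f (Fin.suc i)) (λ i → g (Fin.suc i))

  eqFb-T : ∀ {k} {A : Set} (eqA : A → A → Bool) {f g : Fin k → A} → eqFb eqA f g ≡ true →
           ∀ i → eqA (f i) (g i) ≡ true
  eqFb-T {suc k} eqA e Fin.zero = ∧T₁ e
  eqFb-T {suc k} eqA {f} {g} e (Fin.suc i) = eqFb-T eqA (∧T₂ {eqA (f Fin.zero) (g Fin.zero)} e) i

  T-eqFb : ∀ {k} {A : Set} (eqA : A → A → Bool) {f g : Fin k → A} →
           (∀ i → eqA (f i) (g i) ≡ true) → eqFb eqA f g ≡ true
  T-eqFb {zero} eqA h = P.refl
  T-eqFb {suc k} eqA h = T∧ (h Fin.zero) (T-eqFb eqA (λ i → h (Fin.suc i)))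

  eqR : ∀ {m n} → (Fin m → Fin n → Bool) → (Fin m → Fin n → Bool) → Bool
  eqR = eqFb (eqFb eqB)

  eqR-T : ∀ {m n} (P Q : Fin m → Fin n → Bool) → eqR P Q ≡ true → ∀ x y → P x y ≡ Q x y
  eqR-T P Q e x y = eqB-T (eqFb-T eqB (eqFb-T (eqFb eqB) e x) y)

  T-eqR : ∀ {m n} (P Q : Fin m → Fin n → Bool) → (∀ x y → P x y ≡ Q x y) → eqR P Q ≡ true
  T-eqR P Q h = T-eqFb (eqFb eqB) (λ x → T-eqFb eqB (λ y → T-eqB (h x y)))

  eqR-sym : ∀ {k} (P Q : Rel k) → eqR P Q ≡ eqR Q P
  eqR-sym P Q = bool-ext (λ e → T-eqR Q P (λ x y → P.sym (eqR-T P Q e x y)))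
                         (λ e → T-eqR P Q (λ x y → P.sym (eqR-T Q P e x y)))

  same-eq : ∀ {k} (P Q : Rel k) → sameᵇ (k , P) (k , Q) ≡ eqR P Q
  same-eq {k} P Q with k ℕ.≟ k
  ... | yes P.refl = bool-ext
        (λ e → T-eqR P Q (witness (all? (λ i → all? (λ j → P i j ≟ᵇ Q i j))) e))
        (λ e → dec-true (all? (λ i → all? (λ j → P i j ≟ᵇ Q i j))) (eqR-T P Q e))
  ... | no ¬p = ⊥-elim (¬p P.refl)

  same-size : ∀ {m n} (P : Rel m) (Q : Rel n) → sameᵇ (m , P) (n , Q) ≡ true → m ≡ n
  same-size {m} {n} P Q e with m ℕ.≟ n
  ... | yes q = q
  ... | no _ = ⊥-elim (t≢f (P.sym e))

  same-diff : ∀ {m n} (P : Rel m) (Q : Rel n) → ¬ (m ≡ n) → sameᵇ (m , P) (n , Q) ≡ false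
  same-diff P Q ne = ¬T (λ e → ne (same-size P Q e))

  same⇒ : ∀ {k} (P Q : Rel k) → sameᵇ (k , P) (k , Q) ≡ true → P ≗₂ Q
  same⇒ P Q e = eqR-T P Q (P.trans (P.sym (same-eq P Q)) e)

  ⇒same : ∀ {k} (P Q : Rel k) → P ≗₂ Q → sameᵇ (k , P) (k , Q) ≡ true
  ⇒same P Q h = P.trans (same-eq P Q) (T-eqR P Q h)

  same-refl : ∀ (B : Basis) → sameᵇ B B ≡ true
  same-refl (k , P) = ⇒same P P (λ _ _ → P.refl)

  same-sym : ∀ (B B' : Basis) → sameᵇ B B' ≡ sameᵇ B' B
  same-sym (m , P) (n , Q) = helper (m ℕ.≟ n)
    where
    helper : Dec (m ≡ n) → sameᵇ (m , P) (n , Q) ≡ sameᵇ (n , Q) (m , P)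
    helper (no ne) = P.trans (same-diff P Q ne) (P.sym (same-diff Q P (λ e → ne (P.sym e))))
    helper (yes P.refl) = P.trans (same-eq P Q) (P.trans (eqR-sym P Q) (P.sym (same-eq Q P)))

  same-trans : ∀ (A B C : Basis) → sameᵇ A B ≡ true → sameᵇ B C ≡ sameᵇ A C
  same-trans (m , P) (n , Q) (k , R) e with same-size P Q e
  ... | P.refl = helper (n ℕ.≟ k)
    where
    helper : Dec (n ≡ k) → sameᵇ (n , Q) (k , R) ≡ sameᵇ (n , P) (k , R)
    helper (no ne) = P.trans (same-diff Q R ne) (P.sym (same-diff P R ne))
    helper (yes P.refl) = bool-ext
            (λ e2 → ⇒same P R (λ x y → P.trans (same⇒ P Q e x y) (same⇒ Q R e2 x y)))
            (λ e2 → ⇒same Q R (λ x y → P.trans (P.sym (same⇒ P Q e x y)) (same⇒ P R e2 x y)))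

  same-tr : ∀ A B C → sameᵇ A B ≡ true → sameᵇ B C ≡ true → sameᵇ A C ≡ true
  same-tr A B C e1 e2 = P.trans (P.sym (same-trans A B C e1)) e2

  same-sy : ∀ A B → sameᵇ A B ≡ true → sameᵇ B A ≡ true
  same-sy A B e = P.trans (same-sym B A) e

  allFuns-complete : ∀ {A : Set} (xs : List A) (eqA : A → A → Bool) →
    (∀ a → ∃ λ x → x ∈ xs × eqA x a ≡ true) →
    ∀ k (g : Fin k → A) → ∃ λ f → f ∈ allFuns k xs × eqFb eqA f g ≡ true
  allFuns-complete xs eqA c zero g = (λ ()) , here P.refl , P.refl
  allFuns-complete xs eqA c (suc k) g with c (g Fin.zero) | allFuns-complete xs eqA c k (λ i → g (Fin.suc i))
  ... | a , ma , ea | f , mf , ef =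
    _ , ∈-concatMap⁺ _ (Any.map (λ { P.refl → ∈-map⁺ _ mf }) ma) , T∧ ea ef

  bools-complete : ∀ a → ∃ λ x → x ∈ bools × eqB x a ≡ true
  bools-complete true = true , here P.refl , P.refl
  bools-complete false = false , there (here P.refl) , P.refl

  posetT : ∀ {n} (T : Rel n) → isPosetᵇ T ≡ true → IsPoset T
  posetT T e = witness (isPoset? T) e

  Tposet : ∀ {n} (T : Rel n) → IsPoset T → isPosetᵇ T ≡ true
  Tposet T p = dec-true (isPoset? T) p

  isPosetᵇ-resp : ∀ {n} (A B : Rel n) → A ≗₂ B → isPosetᵇ A ≡ isPosetᵇ B
  isPosetᵇ-resp A B eq = bool-ext (λ e → Tposet B (poset-resp eq (posetT A e)))
                                  (λ e → Tposet A (poset-resp (λ x y → P.sym (eq x y)) (posetT B e)))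

  poset-transfer : ∀ B B' → isPosetᵇ (proj₂ B) ≡ true → sameᵇ B B' ≡ true → isPosetᵇ (proj₂ B') ≡ true
  poset-transfer (k , Q) (k' , Q') h e with same-size Q Q' e
  ... | P.refl = P.trans (P.sym (isPosetᵇ-resp Q Q' (same⇒ Q Q' e))) h

  totality? : ∀ {n} (γ : Rel n) → Dec (∀ a b → γ a b ≡ true ⊎ γ b a ≡ true)
  totality? γ = all? (λ a → all? (λ b → (γ a b ≟ᵇ true) ⊎-dec (γ b a ≟ᵇ true)))

  totalᵇ : ∀ {n} → Rel n → Bool
  totalᵇ γ = isPosetᵇ γ ∧ does (totality? γ)

  totalT : ∀ {n} (γ : Rel n) → totalᵇ γ ≡ true → IsTotalOrder γ
  totalT γ e = record { isPoset = posetT γ (∧T₁ e) ; total = witness (totality? γ) (∧T₂ {isPosetᵇ γ} e) }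

  Ttotal : ∀ {n} (γ : Rel n) → IsTotalOrder γ → totalᵇ γ ≡ true
  Ttotal γ t = T∧ (Tposet γ (IsTotalOrder.isPoset t)) (dec-true (totality? γ) (IsTotalOrder.total t))

  totalᵇ-resp : ∀ {n} (A B : Rel n) → A ≗₂ B → totalᵇ A ≡ totalᵇ B
  totalᵇ-resp A B eq = bool-ext (λ e → Ttotal B (total-resp eq (totalT A e)))
                                (λ e → Ttotal A (total-resp (λ x y → P.sym (eq x y)) (totalT B e)))

  total-transfer : ∀ A A' → sameᵇ A A' ≡ true → totalᵇ (proj₂ A) ≡ totalᵇ (proj₂ A')
  total-transfer (k , Q) (k' , Q') q with same-size Q Q' q
  ... | P.refl = totalᵇ-resp Q Q' (same⇒ Q Q' q)

-- For a Boolean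
-- equality eqA and a function h respecting it, summing ⟦ eqA x a ⟧ * h x over
-- an enumeration that lists every value exactly once (up to eqA) returns
-- h a.  This holds for bools, hence for allFuns k xs (by induction on k),
-- hence for allRel n; for sizes, summing over upTo n picks out one size.
module Enumerations {c ℓ} (K : CommutativeRing c ℓ) where

  open import Defs
  open Bookkeeping
  open DecidableRelations
  open FiniteSums K
  open CommutativeRing K renaming (Carrier to 𝕂)
  open import Level using (_⊔_)
  open import Data.Bool using (Bool; true; false; _∧_)
  open import Data.Nat as ℕ using (ℕ; zero; suc; _≡ᵇ_) renaming (_<ᵇ_ to _<ᴺ_)
  open import Data.Fin as Fin using (Fin)
  open import Data.List using (List; _∷_; map; upTo; applyUpTo)
  open import Data.Product using (Σ; _,_; proj₁)
  open import Relation.Nullary using (Dec; yes; no)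
  open import Relation.Binary.PropositionalEquality as P using (_≡_)

  RespA : ∀ {A : Set} → (A → A → Bool) → (A → 𝕂) → Set ℓ
  RespA eqA h = ∀ x y → eqA x y ≡ true → h x ≈ h y

  DeltaL : ∀ {A : Set} → List A → (A → A → Bool) → Set (c ⊔ ℓ)
  DeltaL xs eqA = ∀ h → RespA eqA h → ∀ a → sumL xs (λ x → ⟦ eqA x a ⟧ * h x) ≈ h a

  record IsBoolEquality {A : Set} (eqA : A → A → Bool) : Set where
    field
      rfl : ∀ a → eqA a a ≡ true
      sub : ∀ a b → eqA a b ≡ true → ∀ c → eqA a c ≡ eqA b c

  eqB-equality : IsBoolEquality eqB
  eqB-equality = record { rfl = λ { true → P.refl ; false → P.refl }
                        ; sub = λ a b e c → P.cong (λ z → eqB z c) (eqB-T e) }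

  eqFb-equality : ∀ {A : Set} {eqA : A → A → Bool} → IsBoolEquality eqA → ∀ {k} → IsBoolEquality (eqFb {k} eqA)
  eqFb-equality {eqA = eqA} E = record
    { rfl = λ a → T-eqFb eqA (λ i → rfl (a i))
    ; sub = λ a b e c → bool-ext
        (λ h → T-eqFb eqA (λ i → P.trans (P.sym (sub (a i) (b i) (eqFb-T eqA e i) (c i))) (eqFb-T eqA h i)))
        (λ h → T-eqFb eqA (λ i → P.trans (sub (a i) (b i) (eqFb-T eqA e i) (c i)) (eqFb-T eqA h i))) }
    where open IsBoolEquality E

  deltaBools : DeltaL bools eqB
  deltaBools h r true = trans (+-cong (*-identityˡ _) (trans (+-identityʳ _) (zeroˡ _))) (+-identityʳ _)
  deltaBools h r false = trans (+-cong (zeroˡ _) (trans (+-identityʳ _) (*-identityˡ _))) (+-identityˡ _)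

  cons : ∀ {k} {A : Set} → A → (Fin k → A) → Fin (suc k) → A
  cons a f Fin.zero = a
  cons a f (Fin.suc i) = f i

  sum-allFuns-suc : ∀ {A : Set} (xs : List A) {eqA : A → A → Bool} → IsBoolEquality eqA → ∀ k
    (F : (Fin (suc k) → A) → 𝕂) → RespA (eqFb eqA) F →
    sumL (allFuns (suc k) xs) F ≈ sumL xs (λ a → sumL (allFuns k xs) (λ f → F (cons a f)))
  sum-allFuns-suc xs E k F RF =
    trans (sumL-concatMap _ xs F) (sumL-cong xs (λ a → trans (sumL-map _ (allFuns k xs) F)
      (sumL-cong (allFuns k xs) (λ f → RF _ _ (T∧ (rfl a) (IsBoolEquality.rfl (eqFb-equality E) f))))))
    where open IsBoolEquality E

  deltaFuns : ∀ {A : Set} (xs : List A) {eqA : A → A → Bool} → IsBoolEquality eqA → DeltaL xs eqA →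
              ∀ k → DeltaL (allFuns k xs) (eqFb eqA)
  deltaFuns xs E D zero h r g = trans (+-identityʳ _) (trans (*-identityˡ _) (r _ _ P.refl))
  deltaFuns xs {eqA} E D (suc k) h r g = begin
    sumL (allFuns (suc k) xs) (λ f → ⟦ eqFb eqA f g ⟧ * h f)
      ≈⟨ sum-allFuns-suc xs E k _ RF ⟩
    sumL xs (λ a → sumL (allFuns k xs) (λ f → ⟦ eqA a g₀ ∧ eqFb eqA f g₊ ⟧ * h (cons a f)))
      ≈⟨ sumL-cong xs (λ a → inner a) ⟩
    sumL xs (λ a → ⟦ eqA a g₀ ⟧ * h (cons a g₊))
      ≈⟨ D (λ a → h (cons a g₊)) (λ a a' e → r _ _ (T∧ e (rflF g₊))) g₀ ⟩
    h (cons g₀ g₊)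
      ≈⟨ r _ _ (T∧ (rfl g₀) (rflF g₊)) ⟩
    h g ∎
    where
    open IsBoolEquality E
    rflF = IsBoolEquality.rfl (eqFb-equality E {k})
    g₀ = g Fin.zero
    g₊ = λ i → g (Fin.suc i)
    RF : RespA (eqFb eqA) (λ f → ⟦ eqFb eqA f g ⟧ * h f)
    RF f f' e = *-cong (⟦≡⟧ (IsBoolEquality.sub (eqFb-equality E) f f' e g)) (r f f' e)
    inner : ∀ a → sumL (allFuns k xs) (λ f → ⟦ eqA a g₀ ∧ eqFb eqA f g₊ ⟧ * h (cons a f))
                  ≈ ⟦ eqA a g₀ ⟧ * h (cons a g₊)
    inner a = trans (sumL-cong (allFuns k xs) (λ f → trans (*-congʳ (⟦∧⟧ (eqA a g₀) _)) (*-assoc _ _ _)))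
               (trans (sym (sumL-*ˡ (allFuns k xs) _ _))
                 (*-congˡ (deltaFuns xs E D k (λ f → h (cons a f)) (λ f f' e → r _ _ (T∧ (rfl a) e)) g₊)))

  deltaRel2 : ∀ m n → DeltaL (allFuns m (allFuns n bools)) eqR
  deltaRel2 m n = deltaFuns (allFuns n bools) (eqFb-equality eqB-equality)
                    (deltaFuns bools eqB-equality deltaBools n) m

  deltaRel : ∀ n → DeltaL (allRel n) eqR
  deltaRel n = deltaRel2 n n

  RespB : (Basis → 𝕂) → Set ℓ
  RespB H = ∀ B B' → sameᵇ B B' ≡ true → H B ≈ H B'

  deltaRelB : ∀ k (H : Basis → 𝕂) → RespB H → ∀ B →
    sumL (allRel k) (λ P → ⟦ sameᵇ (k , P) B ⟧ * H (k , P)) ≈ ⟦ proj₁ B ≡ᵇ k ⟧ * H B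
  deltaRelB k H RH (k' , Q) = helper (k ℕ.≟ k')
    where
    helper : Dec (k ≡ k') → sumL (allRel k) (λ P → ⟦ sameᵇ (k , P) (k' , Q) ⟧ * H (k , P)) ≈ ⟦ k' ≡ᵇ k ⟧ * H (k' , Q)
    helper (yes P.refl) =
      trans (sumL-cong (allRel k) (λ P → *-congʳ (⟦≡⟧ (same-eq P Q))))
        (trans (deltaRel k (λ P → H (k , P)) (λ P P' e → RH _ _ (⇒same P P' (eqR-T P P' e))) Q)
          (trans (sym (*-identityˡ _)) (*-congʳ (⟦≡⟧ (P.sym (≡ᵇ-refl k))))))
    helper (no ne) =
      trans (sumL-0 (allRel k) (λ P → trans (*-congʳ (⟦≡⟧ (same-diff P Q ne))) (zeroˡ _)))
        (trans (sym (zeroˡ _)) (*-congʳ (⟦≡⟧ (P.sym (≡ᵇ-F k' k (λ e → ne (P.sym e)))))))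

  deltaRelB' : ∀ k (H : Basis → 𝕂) → RespB H → ∀ B →
    sumL (allRel k) (λ P → ⟦ sameᵇ B (k , P) ⟧ * H (k , P)) ≈ ⟦ proj₁ B ≡ᵇ k ⟧ * H B
  deltaRelB' k H RH B =
    trans (sumL-cong (allRel k) (λ P → *-congʳ (⟦≡⟧ (same-sym B (k , P))))) (deltaRelB k H RH B)

  -- upTo (suc n) = 0 ∷ map suc (upTo n), in the form used by deltaUpTo.
  applyUpTo-map : ∀ {A : Set} (f : ℕ → A) (g : ℕ → ℕ) n → applyUpTo (λ i → f (g i)) n ≡ map f (applyUpTo g n)
  applyUpTo-map f g zero = P.refl
  applyUpTo-map f g (suc n) = P.cong (f (g 0) ∷_) (applyUpTo-map f (λ i → g (suc i)) n)

  deltaUpTo : ∀ n r (G : ℕ → 𝕂) → sumL (upTo n) (λ m → ⟦ r ≡ᵇ m ⟧ * G m) ≈ ⟦ r <ᴺ n ⟧ * G r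
  deltaUpTo zero r G = sym (zeroˡ _)
  deltaUpTo (suc n) r G =
    trans (+-congˡ (trans (≡⇒≈ (P.cong (λ l → sumL l (λ m → ⟦ r ≡ᵇ m ⟧ * G m)) (applyUpTo-map suc (λ i → i) n)))
                          (sumL-map suc (upTo n) _))) (split r)
    where
    split : ∀ r → ⟦ r ≡ᵇ 0 ⟧ * G 0 + sumL (upTo n) (λ m → ⟦ r ≡ᵇ suc m ⟧ * G (suc m)) ≈ ⟦ r <ᴺ suc n ⟧ * G r
    split zero = trans (+-congˡ (sumL-0 (upTo n) (λ _ → zeroˡ _))) (+-identityʳ _)
    split (suc r) = trans (trans (+-congʳ (zeroˡ _)) (+-identityˡ _)) (deltaUpTo n r (λ m → G (suc m)))

  count-unique : ∀ {p} (φ : Rel p → Bool) (b : Bool) →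
    (∀ P P' → eqR P P' ≡ true → φ P ≡ φ P') →
    (∀ P P' → φ P ≡ true → φ P' ≡ true → eqR P' P ≡ true) →
    (b ≡ true → Σ (Rel p) λ P → φ P ≡ true) → (∀ P → φ P ≡ true → b ≡ true) →
    sumL (allRel p) (λ P → ⟦ φ P ⟧) ≈ ⟦ b ⟧
  count-unique {p} φ b resp uniq exists sound with b in eb
  ... | false = sumL-0 (allRel p) (λ P → ⟦≡⟧ (¬T (λ h → t≢f (P.sym (sound P h)))))
  ... | true with exists P.refl
  ...   | P₀ , h₀ = trans (sumL-cong (allRel p) (λ P → trans (⟦≡⟧ (isP₀ P)) (sym (*-identityʳ _))))
                          (deltaRel p (λ _ → 1#) (λ _ _ _ → refl) P₀)
    where
    isP₀ : ∀ P → φ P ≡ eqR P P₀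
    isP₀ P = bool-ext (λ h → uniq P₀ P h₀ h) (λ q → P.trans (resp P P₀ q) h₀)

-- Coefficients are pairings with indicators of sameᵇ;
-- conversely, for f constant on sameᵇ-classes and supported on sizes ≤ N,
-- ⟪ x , f ⟫ is a combination of the coefficients of x (expand), so it only
-- depends on x up to ≋.  This is how · and Δ are shown to respect ≋.
module Coefficients {c ℓ} (K : CommutativeRing c ℓ) where

  open import Defs
  open Bookkeeping
  open FiniteSums K
  open Enumerations K
  open Alg K
  open CommutativeRing K renaming (Carrier to 𝕂)
  open import Data.Bool using (true; false; _∧_)
  open import Data.Nat as ℕ using (ℕ; suc) renaming (_<ᵇ_ to _<ᴺ_)
  import Data.Nat.Properties as ℕP
  open import Data.List using (List; []; _∷_; map; concatMap; upTo)
  open import Data.Product using (_,_; proj₁; proj₂)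

  ⟪_,_⟫ : Elt → (Basis → 𝕂) → 𝕂
  ⟪ x , f ⟫ = sumL x (λ t → proj₁ t * f (proj₂ t))

  ⟪_,_⟫₂ : Elt₂ → (Basis → Basis → 𝕂) → 𝕂
  ⟪ z , f ⟫₂ = sumL z (λ t → proj₁ t * f (proj₁ (proj₂ t)) (proj₂ (proj₂ t)))

  coeff-cons : ∀ a B x B' → coeff ((a , B) ∷ x) B' ≈ a * ⟦ sameᵇ B B' ⟧ + coeff x B'
  coeff-cons a B x B' with sameᵇ B B'
  ... | true = +-congʳ (sym (*-identityʳ a))
  ... | false = trans (sym (+-identityˡ _)) (+-congʳ (sym (zeroʳ a)))

  coeff≈ : ∀ x T → coeff x T ≈ ⟪ x , (λ B → ⟦ sameᵇ B T ⟧) ⟫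
  coeff≈ [] T = refl
  coeff≈ ((a , B) ∷ x) T = trans (coeff-cons a B x T) (+-congˡ (coeff≈ x T))

  coeff₂-cons : ∀ a R S z R' S' →
                coeff₂ ((a , R , S) ∷ z) R' S' ≈ a * ⟦ sameᵇ R R' ∧ sameᵇ S S' ⟧ + coeff₂ z R' S'
  coeff₂-cons a R S z R' S' with sameᵇ R R' ∧ sameᵇ S S'
  ... | true = +-congʳ (sym (*-identityʳ a))
  ... | false = trans (sym (+-identityˡ _)) (+-congʳ (sym (zeroʳ a)))

  coeff₂≈ : ∀ z R S → coeff₂ z R S ≈ ⟪ z , (λ R' S' → ⟦ sameᵇ R' R ∧ sameᵇ S' S ⟧) ⟫₂
  coeff₂≈ [] R S = refl
  coeff₂≈ ((a , R' , S') ∷ z) R S = trans (coeff₂-cons a R' S' z R S) (+-congˡ (coeff₂≈ z R S))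

  pair-cong : ∀ x {f g : Basis → 𝕂} → (∀ B → f B ≈ g B) → ⟪ x , f ⟫ ≈ ⟪ x , g ⟫
  pair-cong x h = sumL-cong x (λ t → *-congˡ (h (proj₂ t)))

  pair-• : ∀ a x f → ⟪ a • x , f ⟫ ≈ a * ⟪ x , f ⟫
  pair-• a x f = trans (sumL-map _ x _) (trans (sumL-cong x (λ t → *-assoc _ _ _)) (sym (sumL-*ˡ x a _)))

  pair-concatMap : ∀ {a} {A : Set a} (g : A → Elt) (L : List A) f →
                   ⟪ concatMap g L , f ⟫ ≈ sumL L (λ l → ⟪ g l , f ⟫)
  pair-concatMap g L f = sumL-concatMap g L _

  pair₂-•₂ : ∀ a z f → ⟪ a •₂ z , f ⟫₂ ≈ a * ⟪ z , f ⟫₂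
  pair₂-•₂ a z f = trans (sumL-map _ z _) (trans (sumL-cong z (λ t → *-assoc _ _ _)) (sym (sumL-*ˡ z a _)))

  pair₂-concatMap : ∀ {a} {A : Set a} (g : A → Elt₂) (L : List A) f →
                    ⟪ concatMap g L , f ⟫₂ ≈ sumL L (λ l → ⟪ g l , f ⟫₂)
  pair₂-concatMap g L f = sumL-concatMap g L _

  pair-lin : ∀ {a} {A : Set a} x (L : List A) (c : A → 𝕂) (f : A → Basis → 𝕂) →
             ⟪ x , (λ B → sumL L (λ l → c l * f l B)) ⟫ ≈ sumL L (λ l → c l * ⟪ x , f l ⟫)
  pair-lin x L c f =
    trans (sumL-cong x (λ t → sumL-*ˡ L (proj₁ t) _))
    (trans (sumL-swap x L _)
      (sumL-cong L (λ l → trans (sumL-cong x (λ t → x∙yz≈y∙xz _ _ _)) (sym (sumL-*ˡ x (c l) _)))))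

  coeff-concatMap : ∀ {a} {A : Set a} (g : A → Elt) (L : List A) T →
                    coeff (concatMap g L) T ≈ sumL L (λ l → coeff (g l) T)
  coeff-concatMap g L T =
    trans (coeff≈ (concatMap g L) T) (trans (pair-concatMap g L _) (sumL-cong L (λ l → sym (coeff≈ (g l) T))))

  coeff-• : ∀ a x T → coeff (a • x) T ≈ a * coeff x T
  coeff-• a x T = trans (coeff≈ (a • x) T) (trans (pair-• a x _) (*-congˡ (sym (coeff≈ x T))))

  coeff₂-•₂ : ∀ a z R S → coeff₂ (a •₂ z) R S ≈ a * coeff₂ z R S
  coeff₂-•₂ a z R S = trans (coeff₂≈ (a •₂ z) R S) (trans (pair₂-•₂ a z _) (*-congˡ (sym (coeff₂≈ z R S))))

  Supp : ℕ → (Basis → 𝕂) → Set ℓ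
  Supp N f = ∀ B → N ℕ.< proj₁ B → f B ≈ 0#

  labelsUpTo : ℕ → List Basis
  labelsUpTo N = concatMap (λ m → map (λ R → (m , R)) (allRel m)) (upTo (suc N))

  deltaLabels : ∀ N f → RespB f → Supp N f → ∀ B → sumL (labelsUpTo N) (λ B' → ⟦ sameᵇ B B' ⟧ * f B') ≈ f B
  deltaLabels N f Rf Sf B =
    trans (sumL-concatMap (λ m → map (λ R → (m , R)) (allRel m)) (upTo (suc N)) (λ B' → ⟦ sameᵇ B B' ⟧ * f B'))
    (trans (sumL-cong (upTo (suc N)) (λ m → trans (sumL-map (λ R → (m , R)) (allRel m) (λ B' → ⟦ sameᵇ B B' ⟧ * f B'))
                                                  (deltaRelB' m f Rf B)))
    (trans (deltaUpTo (suc N) (proj₁ B) (λ _ → f B)) small))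
    where
    small : ⟦ proj₁ B <ᴺ suc N ⟧ * f B ≈ f B
    small with proj₁ B <ᴺ suc N in eq
    ... | true = *-identityˡ _
    ... | false = trans (zeroˡ _) (sym (Sf B (ℕP.≰⇒> (λ le → FT eq (T-<ᴺ (ℕ.s≤s le))))))

  expand : ∀ N f → RespB f → Supp N f → ∀ x → ⟪ x , f ⟫ ≈ sumL (labelsUpTo N) (λ B → coeff x B * f B)
  expand N f Rf Sf [] = sym (sumL-0 (labelsUpTo N) (λ _ → zeroˡ _))
  expand N f Rf Sf ((a , B) ∷ x) =
    trans (+-cong (*-congˡ (sym (deltaLabels N f Rf Sf B))) (expand N f Rf Sf x))
    (trans (+-congʳ (sumL-*ˡ (labelsUpTo N) a _))
    (trans (sym (sumL-+ (labelsUpTo N) _ _))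
      (sumL-cong (labelsUpTo N) (λ B' → trans (+-congʳ (sym (*-assoc _ _ _)))
          (trans (sym (distribʳ _ _ _)) (*-congʳ (sym (coeff-cons a B x B'))))))))

  pair-≋ : ∀ N f → RespB f → Supp N f → ∀ {x x'} → x ≋ x' → ⟪ x , f ⟫ ≈ ⟪ x' , f ⟫
  pair-≋ N f Rf Sf {x} {x'} eq =
    trans (expand N f Rf Sf x) (trans (sumL-cong (labelsUpTo N) (λ B → *-congʳ (eq B))) (sym (expand N f Rf Sf x')))

module Shuffles {m n : ℕ} where

  open import Defs
  open Bookkeeping
  open LinearExtensions using (_≗₂_)
  open DecidableRelations
  open import Data.Bool using (Bool; true; _∧_)
  open import Data.Nat using (_+_)
  open import Data.Fin using (Fin; _↑ˡ_; _↑ʳ_; splitAt)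
  open import Data.Fin.Properties using (splitAt-↑ˡ; splitAt-↑ʳ; splitAt⁻¹-↑ˡ; splitAt⁻¹-↑ʳ)
  open import Data.Product using (∃; _,_)
  open import Data.Sum using (_⊎_; inj₁; inj₂)
  open import Relation.Binary.PropositionalEquality using (_≡_; refl; sym; trans)

  splitView : (x : Fin (m + n)) → (∃ λ i → i ↑ˡ n ≡ x) ⊎ (∃ λ j → m ↑ʳ j ≡ x)
  splitView x with splitAt m x in eq
  ... | inj₁ i = inj₁ (i , splitAt⁻¹-↑ˡ eq)
  ... | inj₂ j = inj₂ (j , splitAt⁻¹-↑ʳ eq)

  module _ (R : Rel m) (S : Rel n) (I : Fin m → Fin n → Bool) (D : Fin n → Fin m → Bool) where
    shLL : ∀ i j → shuffle R S I D (i ↑ˡ n) (j ↑ˡ n) ≡ R i j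
    shLL i j rewrite splitAt-↑ˡ m i n | splitAt-↑ˡ m j n = refl
    shLR : ∀ i j → shuffle R S I D (i ↑ˡ n) (m ↑ʳ j) ≡ I i j
    shLR i j rewrite splitAt-↑ˡ m i n | splitAt-↑ʳ m n j = refl
    shRL : ∀ i j → shuffle R S I D (m ↑ʳ i) (j ↑ˡ n) ≡ D i j
    shRL i j rewrite splitAt-↑ʳ m n i | splitAt-↑ˡ m j n = refl
    shRR : ∀ i j → shuffle R S I D (m ↑ʳ i) (m ↑ʳ j) ≡ S i j
    shRR i j rewrite splitAt-↑ʳ m n i | splitAt-↑ʳ m n j = refl

  shuffle-cong : ∀ (R R' : Rel m) (S S' : Rel n) I D → R ≗₂ R' → S ≗₂ S' → shuffle R S I D ≗₂ shuffle R' S' I D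
  shuffle-cong R R' S S' I D hR hS x y with splitAt m x | splitAt m y
  ... | inj₁ i | inj₁ j = hR i j
  ... | inj₁ i | inj₂ j = refl
  ... | inj₂ i | inj₁ j = refl
  ... | inj₂ i | inj₂ j = hS i j

  module _ (T : Rel (m + n)) where
    T₁₁ : Rel m
    T₁₁ i j = T (i ↑ˡ n) (j ↑ˡ n)
    T₁₂ : Fin m → Fin n → Bool
    T₁₂ i j = T (i ↑ˡ n) (m ↑ʳ j)
    T₂₁ : Fin n → Fin m → Bool
    T₂₁ i j = T (m ↑ʳ i) (j ↑ˡ n)
    T₂₂ : Rel n
    T₂₂ i j = T (m ↑ʳ i) (m ↑ʳ j)

  sh-eq : ∀ (R : Rel m) (S : Rel n) I D (T : Rel (m + n)) →
    eqR (shuffle R S I D) T ≡ eqR I (T₁₂ T) ∧ (eqR D (T₂₁ T) ∧ (eqR R (T₁₁ T) ∧ eqR S (T₂₂ T)))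
  sh-eq R S I D T = bool-ext fw bw
    where
    sh = shuffle R S I D
    fw : eqR sh T ≡ true → _
    fw e = T∧ (T-eqR I (T₁₂ T) (λ i j → trans (sym (shLR R S I D i j)) (h _ _)))
          (T∧ (T-eqR D (T₂₁ T) (λ i j → trans (sym (shRL R S I D i j)) (h _ _)))
          (T∧ (T-eqR R (T₁₁ T) (λ i j → trans (sym (shLL R S I D i j)) (h _ _)))
              (T-eqR S (T₂₂ T) (λ i j → trans (sym (shRR R S I D i j)) (h _ _)))))
      where h = eqR-T sh T e
    bw : _ → eqR sh T ≡ true
    bw e = T-eqR sh T pw
      where
      e1 = ∧T₁ e
      e2 = ∧T₁ (∧T₂ {eqR I (T₁₂ T)} e)
      e3 = ∧T₁ (∧T₂ {eqR D (T₂₁ T)} (∧T₂ {eqR I (T₁₂ T)} e))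
      e4 = ∧T₂ {eqR R (T₁₁ T)} (∧T₂ {eqR D (T₂₁ T)} (∧T₂ {eqR I (T₁₂ T)} e))
      pw : ∀ x y → sh x y ≡ T x y
      pw x y with splitView x | splitView y
      ... | inj₁ (i , refl) | inj₁ (j , refl) = trans (shLL R S I D i j) (eqR-T R (T₁₁ T) e3 i j)
      ... | inj₁ (i , refl) | inj₂ (j , refl) = trans (shLR R S I D i j) (eqR-T I (T₁₂ T) e1 i j)
      ... | inj₂ (i , refl) | inj₁ (j , refl) = trans (shRL R S I D i j) (eqR-T D (T₂₁ T) e2 i j)
      ... | inj₂ (i , refl) | inj₂ (j , refl) = trans (shRR R S I D i j) (eqR-T S (T₂₂ T) e4 i j)

-- Since a
-- shuffle is determined by its blocks, shuffleCount T R S is 1 exactly when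
-- T is a poset whose diagonal blocks are R and S.
module ShuffleCoefficients {c ℓ} (K : CommutativeRing c ℓ) where

  open import Defs
  open LinearExtensions using (_≗₂_)
  open DecidableRelations
  open FiniteSums K
  open Enumerations K
  open Coefficients K
  open Alg K
  open CommutativeRing K renaming (Carrier to 𝕂)
  open import Data.Bool using (_∧_)
  open import Data.Nat as ℕ using (ℕ)
  import Data.Nat.Properties as ℕP
  open import Data.List using (filterᵇ)
  open import Data.Product using (_×_; _,_; proj₁; proj₂)
  open import Relation.Nullary using (¬_)
  open import Relation.Binary.PropositionalEquality as P using (_≡_)

  shuffleCount : Basis → Basis → Basis → 𝕂
  shuffleCount T (m , R) (n , S) = sumL (filterᵇ isPosetᵇ (Sh R S)) (λ T' → ⟦ sameᵇ (m ℕ.+ n , T') T ⟧)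

  prod-coeff : ∀ x y T → coeff (x · y) T ≈ ⟪ x , (λ R → ⟪ y , (λ S → shuffleCount T R S) ⟫) ⟫
  prod-coeff x y T =
    trans (coeff≈ (x · y) T) (trans (sumL-concatMap _ x (term T)) (sumL-cong x (λ { (a , (m , R)) →
      trans (sumL-concatMap _ y (term T)) (trans (sumL-cong y (λ { (b , (n , S)) →
        trans (sumL-map (λ T' → (a * b , (m ℕ.+ n , T'))) (filterᵇ isPosetᵇ (Sh R S)) (term T))
          (trans (sym (sumL-*ˡ (filterᵇ isPosetᵇ (Sh R S)) (a * b) (λ T' → ⟦ sameᵇ (m ℕ.+ n , T') T ⟧))) (*-assoc a b _)) }))
        (sym (sumL-*ˡ y a _))) })))
    where
    term : Basis → (𝕂 × Basis) → 𝕂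
    term T t = proj₁ t * ⟦ sameᵇ (proj₂ t) T ⟧

  shuffleTerm : ∀ {k} → Basis → Rel k → 𝕂
  shuffleTerm {k} T T' = ⟦ isPosetᵇ T' ⟧ * ⟦ sameᵇ (k , T') T ⟧

  shuffleTerm-resp : ∀ {k} T (A B : Rel k) → A ≗₂ B → shuffleTerm T A ≈ shuffleTerm T B
  shuffleTerm-resp {k} T A B eq =
    *-cong (⟦≡⟧ (isPosetᵇ-resp A B eq)) (⟦≡⟧ (same-trans (k , B) (k , A) T (⇒same B A (λ x y → P.sym (eq x y)))))

  shuffleCount-expand : ∀ T m (R : Rel m) n (S : Rel n) →
    shuffleCount T (m , R) (n , S) ≈
      sumL (allFuns m (allFuns n bools)) (λ I → sumL (allFuns n (allFuns m bools)) (λ D → shuffleTerm T (shuffle R S I D)))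
  shuffleCount-expand T m R n S =
    trans (sumL-filter isPosetᵇ (Sh R S) _)
    (trans (sumL-concatMap _ (allFuns m (allFuns n bools)) _)
      (sumL-cong (allFuns m (allFuns n bools)) (λ I → sumL-map _ (allFuns n (allFuns m bools)) _)))

  shuffleCount-resp : ∀ T m (R R' : Rel m) n (S S' : Rel n) → R ≗₂ R' → S ≗₂ S' →
                      shuffleCount T (m , R) (n , S) ≈ shuffleCount T (m , R') (n , S')
  shuffleCount-resp T m R R' n S S' hR hS =
    trans (shuffleCount-expand T m R n S)
      (trans (sumL-cong (allFuns m (allFuns n bools)) (λ I → sumL-cong (allFuns n (allFuns m bools)) (λ D →
               shuffleTerm-resp T _ _ (Shuffles.shuffle-cong R R' S S' I D hR hS))))
        (sym (shuffleCount-expand T m R' n S')))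

  shuffleCount-resp-R : ∀ T S → RespB (λ R → shuffleCount T R S)
  shuffleCount-resp-R T (n , S) (m , R) (m' , R') eq with same-size R R' eq
  ... | P.refl = shuffleCount-resp T m R R' n S S (same⇒ R R' eq) (λ _ _ → P.refl)

  shuffleCount-resp-S : ∀ T R → RespB (λ S → shuffleCount T R S)
  shuffleCount-resp-S T (m , R) (n , S) (n' , S') eq with same-size S S' eq
  ... | P.refl = shuffleCount-resp T m R R n S S' (λ _ _ → P.refl) (same⇒ S S' eq)

  shuffleCount-zero : ∀ p (T : Rel p) m (R : Rel m) n (S : Rel n) → ¬ (m ℕ.+ n ≡ p) →
                      shuffleCount (p , T) (m , R) (n , S) ≈ 0#
  shuffleCount-zero p T m R n S ne = sumL-0 (filterᵇ isPosetᵇ (Sh R S)) (λ T' → ⟦≡⟧ (same-diff T' T ne))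

  shuffleCount-supp-R : ∀ T S → Supp (proj₁ T) (λ R → shuffleCount T R S)
  shuffleCount-supp-R (p , T) (n , S) (m , R) lt =
    shuffleCount-zero p T m R n S (λ eq → ℕP.<-irrefl P.refl (P.subst (p ℕ.<_) eq (ℕP.<-≤-trans lt (ℕP.m≤m+n m n))))

  shuffleCount-supp-S : ∀ T R → Supp (proj₁ T) (λ S → shuffleCount T R S)
  shuffleCount-supp-S (p , T) (m , R) (n , S) lt =
    shuffleCount-zero p T m R n S (λ eq → ℕP.<-irrefl P.refl (P.subst (p ℕ.<_) eq (ℕP.<-≤-trans lt (ℕP.m≤n+m n m))))

  prod-cong : ∀ {x x' y y'} → x ≋ x' → y ≋ y' → (x · y) ≋ (x' · y')
  prod-cong {x} {x'} {y} {y'} ex ey T = begin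
    coeff (x · y) T
      ≈⟨ prod-coeff x y T ⟩
    ⟪ x , (λ R → ⟪ y , shuffleCount T R ⟫) ⟫
      ≈⟨ pair-cong x (λ R → pair-≋ (proj₁ T) (shuffleCount T R) (shuffleCount-resp-S T R) (shuffleCount-supp-S T R) {y} {y'} ey) ⟩
    ⟪ x , (λ R → ⟪ y' , shuffleCount T R ⟫) ⟫
      ≈⟨ pair-≋ (proj₁ T) (λ R → ⟪ y' , shuffleCount T R ⟫) resp supp {x} {x'} ex ⟩
    ⟪ x' , (λ R → ⟪ y' , shuffleCount T R ⟫) ⟫
      ≈⟨ sym (prod-coeff x' y' T) ⟩
    coeff (x' · y') T ∎
    where
    resp : RespB (λ R → ⟪ y' , shuffleCount T R ⟫)
    resp R R' eq = sumL-cong y' (λ t → *-congˡ (shuffleCount-resp-R T (proj₂ t) R R' eq))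
    supp : Supp (proj₁ T) (λ R → ⟪ y' , shuffleCount T R ⟫)
    supp R lt = sumL-0 y' (λ t → trans (*-congˡ (shuffleCount-supp-R T (proj₂ t) R lt)) (zeroʳ _))

  module _ {m n : ℕ} where
    open Shuffles {m} {n}

    -- Exactly one choice of off-diagonal blocks reproduces T.
    shuffleCount-blocks : ∀ (T : Rel (m ℕ.+ n)) (R : Rel m) (S : Rel n) →
      shuffleCount (m ℕ.+ n , T) (m , R) (n , S) ≈ ⟦ isPosetᵇ T ⟧ * (⟦ eqR R (T₁₁ T) ⟧ * ⟦ eqR S (T₂₂ T) ⟧)
    shuffleCount-blocks T R S = begin
      shuffleCount (m ℕ.+ n , T) (m , R) (n , S)
        ≈⟨ shuffleCount-expand _ m R n S ⟩
      sumL Is (λ I → sumL Ds (λ D → shuffleTerm (m ℕ.+ n , T) (shuffle R S I D)))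
        ≈⟨ sumL-cong Is (λ I → trans (sumL-cong Ds (λ D → term I D)) (sym (sumL-*ˡ Ds _ _))) ⟩
      sumL Is (λ I → ⟦ eqR I (T₁₂ T) ⟧ * sumL Ds (λ D → ⟦ eqR D (T₂₁ T) ⟧ * diag))
        ≈⟨ sumL-cong Is (λ I → *-congˡ (deltaRel2 n m (λ _ → diag) (λ _ _ _ → refl) (T₂₁ T))) ⟩
      sumL Is (λ I → ⟦ eqR I (T₁₂ T) ⟧ * diag)
        ≈⟨ deltaRel2 m n (λ _ → diag) (λ _ _ _ → refl) (T₁₂ T) ⟩
      diag ∎
      where
      Is = allFuns m (allFuns n bools)
      Ds = allFuns n (allFuns m bools)
      diag = ⟦ isPosetᵇ T ⟧ * (⟦ eqR R (T₁₁ T) ⟧ * ⟦ eqR S (T₂₂ T) ⟧)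
      term : ∀ I D → shuffleTerm (m ℕ.+ n , T) (shuffle R S I D) ≈ ⟦ eqR I (T₁₂ T) ⟧ * (⟦ eqR D (T₂₁ T) ⟧ * diag)
      term I D = begin
        ⟦ isPosetᵇ sh ⟧ * ⟦ sameᵇ (m ℕ.+ n , sh) (m ℕ.+ n , T) ⟧ ≈⟨ *-congˡ (⟦≡⟧ (same-eq sh T)) ⟩
        ⟦ isPosetᵇ sh ⟧ * ⟦ eqR sh T ⟧ ≈⟨ ⟦⟧-guarded _ _ _ (λ q → isPosetᵇ-resp sh T (eqR-T sh T q)) ⟩
        ⟦ isPosetᵇ T ⟧ * ⟦ eqR sh T ⟧ ≈⟨ *-congˡ (⟦≡⟧ (sh-eq R S I D T)) ⟩
        ⟦ isPosetᵇ T ⟧ * ⟦ eqR I (T₁₂ T) ∧ (eqR D (T₂₁ T) ∧ (eqR R (T₁₁ T) ∧ eqR S (T₂₂ T))) ⟧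
          ≈⟨ *-congˡ (trans (⟦∧⟧ (eqR I (T₁₂ T)) _) (*-congˡ (trans (⟦∧⟧ (eqR D (T₂₁ T)) _)
                       (*-congˡ (⟦∧⟧ (eqR R (T₁₁ T)) (eqR S (T₂₂ T))))))) ⟩
        ⟦ isPosetᵇ T ⟧ * (⟦ eqR I (T₁₂ T) ⟧ * (⟦ eqR D (T₂₁ T) ⟧ * (⟦ eqR R (T₁₁ T) ⟧ * ⟦ eqR S (T₂₂ T) ⟧)))
          ≈⟨ x∙yz≈y∙xz _ _ _ ⟩
        ⟦ eqR I (T₁₂ T) ⟧ * (⟦ isPosetᵇ T ⟧ * (⟦ eqR D (T₂₁ T) ⟧ * (⟦ eqR R (T₁₁ T) ⟧ * ⟦ eqR S (T₂₂ T) ⟧)))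
          ≈⟨ *-congˡ (x∙yz≈y∙xz _ _ _) ⟩
        ⟦ eqR I (T₁₂ T) ⟧ * (⟦ eqR D (T₂₁ T) ⟧ * diag) ∎
        where sh = shuffle R S I D

module Fibres {c ℓ} (K : CommutativeRing c ℓ) (e : ∀ {n} → Rel n → Rel n) (adm : Admissibility.Admissible e) where

  open import Defs
  open DecidableRelations
  open FiniteSums K
  open Enumerations K
  open Coefficients K
  open Alg K
  open Admissibility.Admissible adm using (resp)
  open CommutativeRing K renaming (Carrier to 𝕂)
  open import Data.Bool using (Bool; true; _∧_)
  open import Data.List using (concatMap; filterᵇ)
  open import Data.Product using (_×_; _,_; proj₁; proj₂)
  open import Relation.Nullary using (¬_)
  open import Relation.Binary.PropositionalEquality as P using (_≡_)

  inFibre : ∀ {n} → Rel n → Rel n → Bool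
  inFibre {n} L P = isPosetᵇ P ∧ sameᵇ (n , e P) (n , L)

  inFibre-resp : ∀ {n} (L : Rel n) P P' → eqR P P' ≡ true → inFibre L P ≡ inFibre L P'
  inFibre-resp {n} L P P' eq = P.cong₂ _∧_ (isPosetᵇ-resp P P' (eqR-T P P' eq))
     (same-trans (n , e P') (n , e P) (n , L) (⇒same (e P') (e P) (resp P' P (λ x y → P.sym (eqR-T P P' eq x y)))))

  pairG : ∀ {n} (L : Rel n) f → ⟪ G e L , f ⟫ ≈ sumL (allRel n) (λ P → ⟦ inFibre L P ⟧ * f (n , P))
  pairG {n} L f =
    trans (sumL-map (λ P → 1# , (n , P)) (filterᵇ (inFibre L) (allRel n)) (λ t → proj₁ t * f (proj₂ t)))
      (trans (sumL-filter (inFibre L) (allRel n) (λ P → 1# * f (n , P)))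
        (sumL-cong (allRel n) (λ P → *-congˡ (*-identityˡ _))))

  coeffG : ∀ {n} (L : Rel n) (T : Rel n) → coeff (G e L) (n , T) ≈ ⟦ inFibre L T ⟧
  coeffG {n} L T = trans (coeff≈ (G e L) (n , T)) (trans (pairG L (λ B → ⟦ sameᵇ B (n , T) ⟧))
    (trans (sumL-cong (allRel n) (λ P → trans (*-comm _ _) (*-congʳ (⟦≡⟧ (same-eq P T)))))
      (deltaRel n (λ P → ⟦ inFibre L P ⟧) (λ P P' q → ⟦≡⟧ (inFibre-resp L P P' q)) T)))

  coeffG-size : ∀ {n} (L : Rel n) p (T : Rel p) → ¬ (n ≡ p) → coeff (G e L) (p , T) ≈ 0#
  coeffG-size {n} L p T ne = trans (coeff≈ (G e L) (p , T)) (trans (pairG L (λ B → ⟦ sameᵇ B (p , T) ⟧))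
    (sumL-0 (allRel n) (λ P → trans (*-congˡ (⟦≡⟧ (same-diff P T ne))) (zeroʳ _))))

  Gt : 𝕂 × Basis → Elt
  Gt t = proj₁ t • G e (proj₂ (proj₂ t))

  pair-Gt : ∀ L f → ⟪ concatMap Gt L , f ⟫ ≈ sumL L (λ t → proj₁ t * ⟪ G e (proj₂ (proj₂ t)) , f ⟫)
  pair-Gt L f = trans (pair-concatMap Gt L f) (sumL-cong L (λ t → pair-• (proj₁ t) (G e (proj₂ (proj₂ t))) f))

-- The product rule  G_α · G_β = Σ { G_γ : γ total, γ|[m] = α, γ|[n]‾ = β }.
-- Coefficientwise at a poset T on [m+n]: the left side counts pairs (P, Q)
-- with e(P) = α, e(Q) = β and T a shuffle of P and Q, i.e. P = T|[m] and
-- Q = T|[n]‾; the right side counts γ = e(T).  These agree because e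
-- commutes with restriction to the blocks (blocks-in-fibres).
module ProductRule {c ℓ} (K : CommutativeRing c ℓ) (e : ∀ {n} → Rel n → Rel n) (adm : Admissibility.Admissible e) where

  open import Defs
  open Bookkeeping
  open Restrictions using (module Restrict; monoL; monoR)
  open DecidableRelations
  open FiniteSums K
  open Enumerations K
  open Coefficients K
  open ShuffleCoefficients K
  open Fibres K e adm
  open Alg K
  open Admissibility.Admissible adm using (tot; restrL; restrR)
  open CommutativeRing K renaming (Carrier to 𝕂)
  open import Data.Bool using (Bool; true; false; _∧_)
  open import Data.Nat as ℕ using (ℕ)
  open import Data.Fin using (_↑ˡ_; _↑ʳ_)
  open import Data.List using (List; map; concatMap; filterᵇ)
  open import Data.List.Relation.Unary.All as All using (All)
  import Data.List.Relation.Unary.All.Properties as AllP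
  open import Data.Product using (_×_; _,_; proj₁; proj₂)
  open import Relation.Nullary using (yes; no)
  open import Relation.Binary.PropositionalEquality as P using (_≡_)

  module _ {m n : ℕ} where
    open Shuffles {m} {n}

    restrictsTo : Rel m → Rel n → Rel (m ℕ.+ n) → Bool
    restrictsTo α β γ = totalᵇ γ ∧ (sameᵇ (m , T₁₁ γ) (m , α) ∧ sameᵇ (n , T₂₂ γ) (n , β))

    restrictsTo-resp : ∀ α β γ γ' → eqR γ γ' ≡ true → restrictsTo α β γ ≡ restrictsTo α β γ'
    restrictsTo-resp α β γ γ' q = P.cong₂ _∧_ (totalᵇ-resp γ γ' h)
      (P.cong₂ _∧_ (same-trans (m , T₁₁ γ') (m , T₁₁ γ) (m , α) (⇒same (T₁₁ γ') (T₁₁ γ) (λ i j → P.sym (h _ _))))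
                   (same-trans (n , T₂₂ γ') (n , T₂₂ γ) (n , β) (⇒same (T₂₂ γ') (T₂₂ γ) (λ i j → P.sym (h _ _)))))
      where h = eqR-T γ γ' q

    blocks-in-fibres : ∀ α β (T : Rel (m ℕ.+ n)) → IsPoset T →
                       (inFibre α (T₁₁ T) ∧ inFibre β (T₂₂ T)) ≡ restrictsTo α β (e T)
    blocks-in-fibres α β T isP
      rewrite Ttotal (e T) (tot T isP)
            | Tposet (T₁₁ T) (Restrict.S-poset T (λ i → i ↑ˡ n) monoL isP)
            | Tposet (T₂₂ T) (Restrict.S-poset T (λ i → m ↑ʳ i) monoR isP)
            = P.cong₂ _∧_
                (P.sym (same-trans (m , e (T₁₁ T)) (m , T₁₁ (e T)) (m , α) (⇒same (e (T₁₁ T)) (T₁₁ (e T)) (restrL T isP))))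
                (P.sym (same-trans (n , e (T₂₂ T)) (n , T₂₂ (e T)) (n , β) (⇒same (e (T₂₂ T)) (T₂₂ (e T)) (restrR T isP))))

    pairG-shuffleCount : ∀ β (T : Rel (m ℕ.+ n)) P →
      ⟪ G e β , shuffleCount (m ℕ.+ n , T) (m , P) ⟫ ≈ ⟦ inFibre β (T₂₂ T) ⟧ * (⟦ isPosetᵇ T ⟧ * ⟦ eqR P (T₁₁ T) ⟧)
    pairG-shuffleCount β T P =
      trans (pairG β _)
        (trans (sumL-cong (allRel n) (λ Q → trans (*-congˡ (shuffleCount-blocks T P Q)) (regroup Q)))
          (deltaRel n (λ Q → ⟦ inFibre β Q ⟧ * (A * ⟦ eqR P (T₁₁ T) ⟧))
                      (λ Q Q' q → *-congʳ (⟦≡⟧ (inFibre-resp β Q Q' q))) (T₂₂ T)))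
      where
      A = ⟦ isPosetᵇ T ⟧
      regroup : ∀ Q → ⟦ inFibre β Q ⟧ * (A * (⟦ eqR P (T₁₁ T) ⟧ * ⟦ eqR Q (T₂₂ T) ⟧)) ≈
                      ⟦ eqR Q (T₂₂ T) ⟧ * (⟦ inFibre β Q ⟧ * (A * ⟦ eqR P (T₁₁ T) ⟧))
      regroup Q = trans (*-congˡ (trans (*-congˡ (*-comm _ _)) (x∙yz≈y∙xz _ _ _))) (x∙yz≈y∙xz _ _ _)

    pairGG-shuffleCount : ∀ α β (T : Rel (m ℕ.+ n)) →
      ⟪ G e α , (λ R → ⟪ G e β , shuffleCount (m ℕ.+ n , T) R ⟫) ⟫ ≈ ⟦ isPosetᵇ T ⟧ * ⟦ restrictsTo α β (e T) ⟧
    pairGG-shuffleCount α β T = begin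
      ⟪ G e α , (λ R → ⟪ G e β , shuffleCount (m ℕ.+ n , T) R ⟫) ⟫
        ≈⟨ pairG α _ ⟩
      sumL (allRel m) (λ P → ⟦ inFibre α P ⟧ * ⟪ G e β , shuffleCount (m ℕ.+ n , T) (m , P) ⟫)
        ≈⟨ sumL-cong (allRel m) (λ P → trans (*-congˡ (pairG-shuffleCount β T P)) (regroup P)) ⟩
      sumL (allRel m) (λ P → ⟦ eqR P (T₁₁ T) ⟧ * (⟦ inFibre α P ⟧ * (⟦ inFibre β (T₂₂ T) ⟧ * A)))
        ≈⟨ deltaRel m (λ P → ⟦ inFibre α P ⟧ * (⟦ inFibre β (T₂₂ T) ⟧ * A))
                      (λ P P' q → *-congʳ (⟦≡⟧ (inFibre-resp α P P' q))) (T₁₁ T) ⟩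
      ⟦ inFibre α (T₁₁ T) ⟧ * (⟦ inFibre β (T₂₂ T) ⟧ * A)
        ≈⟨ diagonal ⟩
      A * ⟦ restrictsTo α β (e T) ⟧ ∎
      where
      A = ⟦ isPosetᵇ T ⟧
      regroup : ∀ P → ⟦ inFibre α P ⟧ * (⟦ inFibre β (T₂₂ T) ⟧ * (A * ⟦ eqR P (T₁₁ T) ⟧)) ≈
                      ⟦ eqR P (T₁₁ T) ⟧ * (⟦ inFibre α P ⟧ * (⟦ inFibre β (T₂₂ T) ⟧ * A))
      regroup P = trans (*-congˡ (trans (sym (*-assoc _ _ _)) (*-comm _ _))) (x∙yz≈y∙xz _ _ _)
      diagonal : ⟦ inFibre α (T₁₁ T) ⟧ * (⟦ inFibre β (T₂₂ T) ⟧ * A) ≈ A * ⟦ restrictsTo α β (e T) ⟧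
      diagonal with isPosetᵇ T in isP
      ... | false = trans (*-congˡ (zeroʳ _)) (trans (zeroʳ _) (sym (zeroˡ _)))
      ... | true = begin
        ⟦ inFibre α (T₁₁ T) ⟧ * (⟦ inFibre β (T₂₂ T) ⟧ * 1#) ≈⟨ *-congˡ (*-identityʳ _) ⟩
        ⟦ inFibre α (T₁₁ T) ⟧ * ⟦ inFibre β (T₂₂ T) ⟧ ≈⟨ sym (⟦∧⟧ (inFibre α (T₁₁ T)) _) ⟩
        ⟦ inFibre α (T₁₁ T) ∧ inFibre β (T₂₂ T) ⟧ ≈⟨ ⟦≡⟧ (blocks-in-fibres α β T (posetT T isP)) ⟩
        ⟦ restrictsTo α β (e T) ⟧ ≈⟨ sym (*-identityˡ _) ⟩
        1# * ⟦ restrictsTo α β (e T) ⟧ ∎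

    -- Right side: among the G_γ only γ = e(T) contains F_T.
    sum-restrictsTo : ∀ α β (T : Rel (m ℕ.+ n)) →
      sumL (filterᵇ (restrictsTo α β) (allRel (m ℕ.+ n))) (λ γ → coeff (G e γ) (m ℕ.+ n , T))
        ≈ ⟦ isPosetᵇ T ⟧ * ⟦ restrictsTo α β (e T) ⟧
    sum-restrictsTo α β T = begin
      sumL (filterᵇ (restrictsTo α β) (allRel (m ℕ.+ n))) (λ γ → coeff (G e γ) (m ℕ.+ n , T))
        ≈⟨ sumL-filter (restrictsTo α β) (allRel (m ℕ.+ n)) _ ⟩
      sumL (allRel (m ℕ.+ n)) (λ γ → ⟦ restrictsTo α β γ ⟧ * coeff (G e γ) (m ℕ.+ n , T))
        ≈⟨ sumL-cong (allRel (m ℕ.+ n)) (λ γ → trans (*-congˡ (trans (coeffG γ T) (fibre γ))) (regroup γ)) ⟩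
      sumL (allRel (m ℕ.+ n)) (λ γ → ⟦ eqR γ (e T) ⟧ * (A * ⟦ restrictsTo α β γ ⟧))
        ≈⟨ deltaRel (m ℕ.+ n) (λ γ → A * ⟦ restrictsTo α β γ ⟧)
                    (λ γ γ' q → *-congˡ (⟦≡⟧ (restrictsTo-resp α β γ γ' q))) (e T) ⟩
      A * ⟦ restrictsTo α β (e T) ⟧ ∎
      where
      A = ⟦ isPosetᵇ T ⟧
      fibre : ∀ γ → ⟦ inFibre γ T ⟧ ≈ A * ⟦ eqR γ (e T) ⟧
      fibre γ = trans (⟦∧⟧ (isPosetᵇ T) _) (*-congˡ (⟦≡⟧ (P.trans (same-eq (e T) γ) (eqR-sym (e T) γ))))
      regroup : ∀ γ → ⟦ restrictsTo α β γ ⟧ * (A * ⟦ eqR γ (e T) ⟧) ≈ ⟦ eqR γ (e T) ⟧ * (A * ⟦ restrictsTo α β γ ⟧)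
      regroup γ = trans (x∙yz≈y∙xz _ _ _) (trans (*-congˡ (*-comm _ _)) (x∙yz≈y∙xz _ _ _))

    product-rule : ∀ (α : Rel m) (β : Rel n) T →
      ⟪ G e α , (λ R → ⟪ G e β , shuffleCount T R ⟫) ⟫
        ≈ sumL (filterᵇ (restrictsTo α β) (allRel (m ℕ.+ n))) (λ γ → coeff (G e γ) T)
    product-rule α β (p , T) with m ℕ.+ n ℕ.≟ p
    ... | yes P.refl = trans (pairGG-shuffleCount α β T) (sym (sum-restrictsTo α β T))
    ... | no ne =
      trans (pairG α _) (trans (sumL-0 (allRel m) (λ P → trans (*-congˡ (trans (pairG β _)
               (sumL-0 (allRel n) (λ Q → trans (*-congˡ (shuffleCount-zero p T m P n Q ne)) (zeroʳ _))))) (zeroʳ _)))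
        (sym (sumL-0 (filterᵇ (restrictsTo α β) (allRel (m ℕ.+ n))) (λ γ → coeffG-size γ p T ne))))

  productTerms : List (𝕂 × Basis) → List (𝕂 × Basis) → List (𝕂 × Basis)
  productTerms Lx Ly =
    concatMap (λ { (a , (m , α)) → concatMap (λ { (b , (n , β)) →
      map (λ γ → (a * b , (m ℕ.+ n , γ))) (filterᵇ (restrictsTo α β) (allRel (m ℕ.+ n))) }) Ly }) Lx

  productTerms-total : ∀ Lx Ly → All (λ t → IsTotalOrder (proj₂ (proj₂ t))) (productTerms Lx Ly)
  productTerms-total Lx Ly = All-concatMap _ Lx (λ t → All-concatMap _ Ly (λ s →
    AllP.map⁺ (All.map (λ {γ} q → totalT γ (∧T₁ q)) (All-filterᵇ _ (allRel _)))))

  prod-span : ∀ x y Lx Ly → x ≋ concatMap Gt Lx → y ≋ concatMap Gt Ly → (x · y) ≋ concatMap Gt (productTerms Lx Ly)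
  prod-span x y Lx Ly ex ey T = begin
    coeff (x · y) T
      ≈⟨ prod-cong {x} {concatMap Gt Lx} {y} {concatMap Gt Ly} ex ey T ⟩
    coeff (concatMap Gt Lx · concatMap Gt Ly) T
      ≈⟨ prod-coeff (concatMap Gt Lx) (concatMap Gt Ly) T ⟩
    ⟪ concatMap Gt Lx , (λ R → ⟪ concatMap Gt Ly , shuffleCount T R ⟫) ⟫
      ≈⟨ pair-Gt Lx _ ⟩
    sumL Lx (λ t → proj₁ t * ⟪ G e (proj₂ (proj₂ t)) , (λ R → ⟪ concatMap Gt Ly , shuffleCount T R ⟫) ⟫)
      ≈⟨ sumL-cong Lx (λ t → *-congˡ (trans (pair-cong (G e (proj₂ (proj₂ t))) (λ R → pair-Gt Ly (shuffleCount T R)))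
                    (pair-lin (G e (proj₂ (proj₂ t))) Ly proj₁ (λ s R → ⟪ G e (proj₂ (proj₂ s)) , shuffleCount T R ⟫)))) ⟩
    sumL Lx (λ t → proj₁ t * sumL Ly (λ s → proj₁ s *
      ⟪ G e (proj₂ (proj₂ t)) , (λ R → ⟪ G e (proj₂ (proj₂ s)) , shuffleCount T R ⟫) ⟫))
      ≈⟨ sumL-cong Lx (λ t → *-congˡ (sumL-cong Ly (λ s → *-congˡ (product-rule (proj₂ (proj₂ t)) (proj₂ (proj₂ s)) T)))) ⟩
    sumL Lx (λ t → proj₁ t * sumL Ly (λ s → proj₁ s * sumL (Γ t s) (λ γ → coeff (G e γ) T)))
      ≈⟨ sym expandTerms ⟩
    coeff (concatMap Gt (productTerms Lx Ly)) T ∎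
    where
    Γ : (t s : 𝕂 × Basis) → List (Rel (proj₁ (proj₂ t) ℕ.+ proj₁ (proj₂ s)))
    Γ t s = filterᵇ (restrictsTo (proj₂ (proj₂ t)) (proj₂ (proj₂ s))) (allRel _)
    expandTerms : coeff (concatMap Gt (productTerms Lx Ly)) T ≈
                  sumL Lx (λ t → proj₁ t * sumL Ly (λ s → proj₁ s * sumL (Γ t s) (λ γ → coeff (G e γ) T)))
    expandTerms =
      trans (coeff-concatMap Gt (productTerms Lx Ly) T)
      (trans (sumL-concatMap _ Lx _)
      (sumL-cong Lx (λ t → trans (sumL-concatMap _ Ly _)
        (trans (sumL-cong Ly (λ s → trans (sumL-map _ (Γ t s) _)
                (trans (sumL-cong (Γ t s) (λ γ → trans (coeff-• (proj₁ t * proj₁ s) (G e γ) T) (*-assoc _ _ _)))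
                  (trans (sym (sumL-*ˡ (Γ t s) (proj₁ t) _)) (*-congˡ (sym (sumL-*ˡ (Γ t s) (proj₁ s) _)))))))
          (sym (sumL-*ˡ Ly (proj₁ t) _))))))

module Gluing where

  open import Defs
  open Bookkeeping
  open LinearExtensions using (_≗₂_)
  open Cuts
  open DecidableRelations
  open import Data.Bool using (Bool; true; false; not)
  open import Data.Nat as ℕ using (ℕ)
  import Data.Nat.Properties as ℕP
  open import Data.Fin using (Fin)
  open import Data.List using ([]; _∷_; length; filterᵇ; allFin)
  open import Data.List.Membership.Propositional using (_∈_)
  open import Data.List.Membership.Propositional.Properties using (∈-allFin)
  open import Data.List.Relation.Unary.Any using (here; there)
  open import Data.Product using (∃; _×_; _,_; proj₁; proj₂)
  open import Data.Sum using (_⊎_; inj₁; inj₂)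
  open import Data.Empty using (⊥-elim)
  open import Relation.Binary.PropositionalEquality using (_≡_; refl; sym; trans; cong; cong₂)

  filterᵇ-cong : ∀ {A : Set} (X X' : A → Bool) → (∀ z → X z ≡ X' z) → ∀ xs → filterᵇ X xs ≡ filterᵇ X' xs
  filterᵇ-cong X X' h [] = refl
  filterᵇ-cong X X' h (x ∷ xs) with X x in e1 | X' x in e2
  ... | true | true = cong (x ∷_) (filterᵇ-cong X X' h xs)
  ... | false | false = filterᵇ-cong X X' h xs
  ... | true | false = ⊥-elim (t≢f (trans (sym e1) (trans (h x) e2)))
  ... | false | true = ⊥-elim (t≢f (trans (sym e2) (trans (sym (h x)) e1)))

  restrict-same : ∀ {p} (T : Rel p) (X X' : Fin p → Bool) → (∀ z → X z ≡ X' z) → sameᵇ (restrict T X) (restrict T X') ≡ true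
  restrict-same {p} T X X' h rewrite filterᵇ-cong X X' h (allFin p) = same-refl (restrict T X')

  restrict-resp : ∀ {p} (T T' : Rel p) (X : Fin p → Bool) → T ≗₂ T' → sameᵇ (restrict T X) (restrict T' X) ≡ true
  restrict-resp T T' X h = ⇒same (proj₂ (restrict T X)) (proj₂ (restrict T' X)) (λ i j → h _ _)

  cut-respT : ∀ {p} {A B : Rel p} {X} → A ≗₂ B → Cut A X → Cut B X
  cut-respT h c x y hx hy = trans (sym (h x y)) (proj₁ (c x y hx hy)) , trans (sym (h y x)) (proj₂ (c x y hx hy))

  cut-respX : ∀ {p} {T : Rel p} {X X'} → (∀ z → X z ≡ X' z) → Cut T X → Cut T X'
  cut-respX h c x y hx hy = c x y (trans (h x) hx) (trans (h y) hy)

  len-sub : ∀ {A : Set} (X X' : A → Bool) → (∀ w → X' w ≡ true → X w ≡ true) → ∀ xs →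
            length (filterᵇ X' xs) ℕ.≤ length (filterᵇ X xs)
  len-sub X X' h [] = ℕ.z≤n
  len-sub X X' h (x ∷ xs) with X' x in e1 | X x in e2
  ... | true | true = ℕ.s≤s (len-sub X X' h xs)
  ... | false | true = ℕP.m≤n⇒m≤1+n (len-sub X X' h xs)
  ... | false | false = len-sub X X' h xs
  ... | true | false = ⊥-elim (t≢f (trans (sym (h x e1)) e2))

  len-strict : ∀ {A : Set} (X X' : A → Bool) → (∀ w → X' w ≡ true → X w ≡ true) → ∀ {z} xs → z ∈ xs →
               X z ≡ true → X' z ≡ false → length (filterᵇ X' xs) ℕ.< length (filterᵇ X xs)
  len-strict X X' h (x ∷ xs) (here refl) hz hz' rewrite hz | hz' = ℕ.s≤s (len-sub X X' h xs)
  len-strict X X' h (x ∷ xs) (there m) hz hz' with X' x in e1 | X x in e2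
  ... | true | true = ℕ.s≤s (len-strict X X' h xs m hz hz')
  ... | false | true = ℕP.m≤n⇒m≤1+n (len-strict X X' h xs m hz hz')
  ... | false | false = len-strict X X' h xs m hz hz'
  ... | true | false = ⊥-elim (t≢f (trans (sym (h x e1)) e2))

  -- Total cuts of T are nested (one side contains the other), so two total
  -- cuts of the same size coincide.
  cut-unique : ∀ {p} (T : Rel p) X X' → Cut T X → Cut T X' → length (elems X) ≡ length (elems X') → ∀ z → X z ≡ X' z
  cut-unique {p} T X X' c c' eq z with X z in e1 | X' z in e2
  ... | true | true = refl
  ... | false | false = refl
  ... | true | false = ⊥-elim (ℕP.<-irrefl (sym eq) (len-strict X X' sub (allFin p) (∈-allFin z) e1 e2))
    where
    sub : ∀ w → X' w ≡ true → X w ≡ true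
    sub w hw = ¬F (λ hx → FT (proj₂ (c z w e1 hx)) (proj₁ (c' w z hw e2)))
  ... | false | true = ⊥-elim (ℕP.<-irrefl eq (len-strict X' X sub (allFin p) (∈-allFin z) e2 e1))
    where
    sub : ∀ w → X w ≡ true → X' w ≡ true
    sub w hw = ¬F (λ hx → FT (proj₂ (c' z w e2 hx)) (proj₁ (c w z hw e1)))

  module TwoSided {p} (X : Fin p → Bool) where
    Y : Fin p → Bool
    Y x = not (X x)
    module EX = Elems X
    module EY = Elems Y
    fX = EX.fz
    fY = EY.fz

    side : ∀ z → (X z ≡ true × ∃ λ i → fX i ≡ z) ⊎ (X z ≡ false × ∃ λ j → fY j ≡ z)
    side z with X z in ez
    ... | true = inj₁ (refl , EX.preZ z ez)
    ... | false = inj₂ (refl , EY.preZ z (Tnot ez))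

    inX : ∀ i → X (fX i) ≡ true
    inX = EX.inZ
    inY : ∀ j → X (fY j) ≡ false
    inY j = notT (EY.inZ j)

    determination : ∀ (A B : Rel p) → Cut A X → Cut B X →
      (∀ i j → A (fX i) (fX j) ≡ B (fX i) (fX j)) → (∀ i j → A (fY i) (fY j) ≡ B (fY i) (fY j)) → A ≗₂ B
    determination A B cA cB hX hY z w with side z | side w
    ... | inj₁ (_ , i , refl) | inj₁ (_ , j , refl) = hX i j
    ... | inj₂ (_ , i , refl) | inj₂ (_ , j , refl) = hY i j
    ... | inj₁ (ez , _) | inj₂ (ew , _) = trans (proj₁ (cA z w ez ew)) (sym (proj₁ (cB z w ez ew)))
    ... | inj₂ (ez , _) | inj₁ (ew , _) = trans (proj₂ (cA w z ew ez)) (sym (proj₂ (cB w z ew ez)))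

    cut-poset : ∀ (T : Rel p) → Cut T X → IsPoset (λ i j → T (fX i) (fX j)) → IsPoset (λ i j → T (fY i) (fY j)) → IsPoset T
    cut-poset T c PX PY = record { reflexive = rf ; antisymmetric = as ; transitive = tr }
      where
      module PX = IsPoset PX
      module PY = IsPoset PY
      rf : ∀ a → T a a ≡ true
      rf a with side a
      ... | inj₁ (_ , i , refl) = PX.reflexive i
      ... | inj₂ (_ , i , refl) = PY.reflexive i
      as : ∀ a b → T a b ≡ true → T b a ≡ true → a ≡ b
      as a b h1 h2 with side a | side b
      ... | inj₁ (_ , i , refl) | inj₁ (_ , j , refl) = cong fX (PX.antisymmetric i j h1 h2)
      ... | inj₂ (_ , i , refl) | inj₂ (_ , j , refl) = cong fY (PY.antisymmetric i j h1 h2)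
      ... | inj₁ (ea , _) | inj₂ (eb , _) = ⊥-elim (FT (proj₂ (c a b ea eb)) h2)
      ... | inj₂ (ea , _) | inj₁ (eb , _) = ⊥-elim (FT (proj₂ (c b a eb ea)) h1)
      tr : ∀ a b d → T a b ≡ true → T b d ≡ true → T a d ≡ true
      tr a b d h1 h2 with side a | side b | side d
      ... | inj₁ (_ , i , refl) | inj₁ (_ , j , refl) | inj₁ (_ , k , refl) = PX.transitive i j k h1 h2
      ... | inj₂ (_ , i , refl) | inj₂ (_ , j , refl) | inj₂ (_ , k , refl) = PY.transitive i j k h1 h2
      ... | inj₁ (ea , _) | _ | inj₂ (ed , _) = proj₁ (c a d ea ed)
      ... | inj₂ (ea , _) | inj₁ (eb , _) | _ = ⊥-elim (FT (proj₂ (c b a eb ea)) h1)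
      ... | inj₂ (ea , _) | inj₂ (eb , _) | inj₁ (ed , _) = ⊥-elim (FT (proj₂ (c d b ed eb)) h2)
      ... | inj₁ (ea , _) | inj₂ (eb , _) | inj₁ (ed , _) = ⊥-elim (FT (proj₂ (c d b ed eb)) h2)

    -- H receives the side of each argument together with its evidence, so
    -- that its defining clauses can be used directly.
    module Glue (R : Rel (length (elems X))) (S : Rel (length (elems Y))) where
      idxX : (z : Fin p) → X z ≡ true → Fin (length (elems X))
      idxX z h = proj₁ (EX.preZ z h)
      idxY : (z : Fin p) → X z ≡ false → Fin (length (elems Y))
      idxY z h = proj₁ (EY.preZ z (Tnot h))

      H : (z w : Fin p) (bz : Bool) → X z ≡ bz → (bw : Bool) → X w ≡ bw → Bool
      H z w true hz true hw = R (idxX z hz) (idxX w hw)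
      H z w true hz false hw = true
      H z w false hz true hw = false
      H z w false hz false hw = S (idxY z hz) (idxY w hw)

      glued : Rel p
      glued z w = H z w (X z) refl (X w) refl

      idxX-f : ∀ i h → idxX (fX i) h ≡ i
      idxX-f i h = EX.injZ (proj₂ (EX.preZ (fX i) h))
      idxY-f : ∀ i h → idxY (fY i) h ≡ i
      idxY-f i h = EY.injZ (proj₂ (EY.preZ (fY i) (Tnot h)))

      HXX : ∀ i j bz hz bw hw → H (fX i) (fX j) bz hz bw hw ≡ R i j
      HXX i j true hz true hw = cong₂ R (idxX-f i hz) (idxX-f j hw)
      HXX i j false hz _ _ = ⊥-elim (FT hz (inX i))
      HXX i j true hz false hw = ⊥-elim (FT hw (inX j))

      HYY : ∀ i j bz hz bw hw → H (fY i) (fY j) bz hz bw hw ≡ S i j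
      HYY i j false hz false hw = cong₂ S (idxY-f i hz) (idxY-f j hw)
      HYY i j true hz _ _ = ⊥-elim (FT (inY i) hz)
      HYY i j false hz true hw = ⊥-elim (FT (inY j) hw)

      glued-X : ∀ i j → glued (fX i) (fX j) ≡ R i j
      glued-X i j = HXX i j _ refl _ refl
      glued-Y : ∀ i j → glued (fY i) (fY j) ≡ S i j
      glued-Y i j = HYY i j _ refl _ refl

      H-below : ∀ x y bz hz bw hw → X x ≡ true → X y ≡ false → H x y bz hz bw hw ≡ true
      H-below x y true hz false hw hx hy = refl
      H-below x y false hz _ _ hx hy = ⊥-elim (FT hz hx)
      H-below x y true hz true hw hx hy = ⊥-elim (FT hy hw)
      H-not-above : ∀ x y bz hz bw hw → X x ≡ true → X y ≡ false → H y x bz hz bw hw ≡ false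
      H-not-above x y false hz true hw hx hy = refl
      H-not-above x y true hz _ _ hx hy = ⊥-elim (FT hy hz)
      H-not-above x y false hz false hw hx hy = ⊥-elim (FT hw hx)

      glued-cut : Cut glued X
      glued-cut x y hx hy = H-below x y _ refl _ refl hx hy , H-not-above x y _ refl _ refl hx hy

module StarMembership where

  open import Defs
  open Bookkeeping
  open LinearExtensions using (_≗₂_)
  open Restrictions using (module Restrict)
  open Cuts
  open DecidableRelations
  open Gluing
  open import Data.Bool using (Bool; true; not)
  open import Data.Fin using (Fin)
  open import Data.Product using (Σ; _×_; _,_; proj₂)
  open import Relation.Binary.PropositionalEquality using (_≡_; sym; cong)

  restrict-poset : ∀ {p} (T : Rel p) Z → IsPoset T → isPosetᵇ (proj₂ (restrict T Z)) ≡ true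
  restrict-poset T Z isP = Tposet _ (Restrict.S-poset T (Elems.fz Z) (Elems.monoZ Z) isP)

  InStar : ∀ {p} → Rel p → Basis → Basis → Set
  InStar {p} T R S = Σ (Fin p → Bool) λ X → Cut T X × sameᵇ (restrict T X) R ≡ true × sameᵇ (restrict T (λ x → not (X x))) S ≡ true

  inStar→ : ∀ {p} (T : Rel p) R S → inStarᵇ T R S ≡ true → InStar T R S
  inStar→ {p} T R S e with anyT _ (allSubsets p) e
  ... | X , h = X , cutT T X (∧T₁ h) , ∧T₁ (∧T₂ {totalCutᵇ T X} h) , ∧T₂ {sameᵇ (restrict T X) R} (∧T₂ {totalCutᵇ T X} h)

  →inStar : ∀ {p} (T : Rel p) R S → InStar T R S → inStarᵇ T R S ≡ true
  →inStar {p} T R S (X , c , hR , hS) with allFuns-complete bools eqB bools-complete p X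
  ... | X' , mX' , eX' = Tany _ mX' (T∧ (Tcut T X' (cut-respX (λ z → sym (h z)) c))
                          (T∧ (same-tr (restrict T X') (restrict T X) R (restrict-same T X' X h) hR)
                              (same-tr (restrict T (λ x → not (X' x))) (restrict T (λ x → not (X x))) S
                                 (restrict-same T _ _ (λ z → cong not (h z))) hS)))
    where
    h : ∀ z → X' z ≡ X z
    h z = eqB-T (eqFb-T eqB eX' z)

  inStar-resp-T : ∀ {p} (T T' : Rel p) R S → T ≗₂ T' → inStarᵇ T R S ≡ inStarᵇ T' R S
  inStar-resp-T T T' R S h = bool-ext (λ e → →inStar T' R S (go T T' h (inStar→ T R S e)))
                                      (λ e → →inStar T R S (go T' T (λ x y → sym (h x y)) (inStar→ T' R S e)))
    where
    go : ∀ A B → A ≗₂ B → InStar A R S → InStar B R S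
    go A B h (X , c , hR , hS) = X , cut-respT h c ,
       same-tr (restrict B X) (restrict A X) R (restrict-resp B A X (λ x y → sym (h x y))) hR ,
       same-tr (restrict B _) (restrict A _) S (restrict-resp B A _ (λ x y → sym (h x y))) hS

  inStar-resp-RS : ∀ {p} (T : Rel p) R S R' S' → sameᵇ R R' ≡ true → sameᵇ S S' ≡ true → inStarᵇ T R S ≡ inStarᵇ T R' S'
  inStar-resp-RS T R S R' S' eR eS = bool-ext
    (λ e → let (X , c , hR , hS) = inStar→ T R S e in
           →inStar T R' S' (X , c , same-tr (restrict T X) R R' hR eR , same-tr (restrict T (λ x → not (X x))) S S' hS eS))
    (λ e → let (X , c , hR , hS) = inStar→ T R' S' e in
           →inStar T R S (X , c , same-tr (restrict T X) R' R hR (same-sy R R' eR) , same-tr (restrict T (λ x → not (X x))) S' S hS (same-sy S S' eS)))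


-- For a total order γ and
-- labels R, S, the posets P with e(P) = γ and P ∈ R ⋆ S are: none, unless R
-- and S are posets with γ ∈ e(R) ⋆ e(S); in that case exactly one, namely
-- the relation glued from R and S along the cut of γ.
module StarFibres (e : ∀ {n} → Rel n → Rel n) (adm : Admissibility.Admissible e) where

  open import Defs
  open Bookkeeping
  open LinearExtensions using (_≗₂_; poset-resp)
  open Cuts
  open DecidableRelations
  open Gluing
  open StarMembership
  open Admissibility.Admissible adm
  open import Data.Bool using (Bool; true; _∧_; not)
  open import Data.Fin using (Fin)
  open import Data.Product using (Σ; _,_; proj₂)
  open import Relation.Binary.PropositionalEquality using (_≡_; refl; sym; trans; cong)

  eB : Basis → Basis
  eB (k , P) = (k , e P)

  eB-same : ∀ B B' → sameᵇ B B' ≡ true → sameᵇ (eB B) (eB B') ≡ true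
  eB-same (k , Q) (k' , Q') h with same-size Q Q' h
  ... | refl = ⇒same (e Q) (e Q') (resp Q Q' (same⇒ Q Q' h))

  module _ {p} (γ : Rel p) (R S : Basis) where
    fibreStar : Rel p → Bool
    fibreStar P = (isPosetᵇ P ∧ sameᵇ (p , e P) (p , γ)) ∧ inStarᵇ P R S

    extStar : Bool
    extStar = (isPosetᵇ (proj₂ R) ∧ isPosetᵇ (proj₂ S)) ∧ inStarᵇ γ (eB R) (eB S)

    -- e maps the cut of P and its two sides to a cut of γ and e of the sides.
    fibre⇒star : ∀ P → fibreStar P ≡ true → extStar ≡ true
    fibre⇒star P h with inStar→ P R S (∧T₂ {isPosetᵇ P ∧ sameᵇ (p , e P) (p , γ)} h)
    ... | X , c , hR , hS = T∧ (T∧ (poset-transfer (restrict P X) R (restrict-poset P X isP) hR)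
                                   (poset-transfer (restrict P Y) S (restrict-poset P Y isP) hS))
                               (→inStar γ (eB R) (eB S) (X , cut-respT eqγ (cutE P isP X c) , sX , sY))
      where
      h1 = ∧T₁ h
      isP = posetT P (∧T₁ h1)
      eqγ : e P ≗₂ γ
      eqγ = same⇒ (e P) γ (∧T₂ {isPosetᵇ P} h1)
      Y : Fin p → Bool
      Y x = not (X x)
      sX : sameᵇ (restrict γ X) (eB R) ≡ true
      sX = same-tr (restrict γ X) (restrict (e P) X) (eB R) (restrict-resp γ (e P) X (λ x y → sym (eqγ x y)))
             (same-tr (restrict (e P) X) (eB (restrict P X)) (eB R)
               (⇒same (proj₂ (restrict (e P) X)) (e (proj₂ (restrict P X))) (λ i j → sym (cutX P isP X c i j)))
               (eB-same (restrict P X) R hR))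
      sY : sameᵇ (restrict γ Y) (eB S) ≡ true
      sY = same-tr (restrict γ Y) (restrict (e P) Y) (eB S) (restrict-resp γ (e P) Y (λ x y → sym (eqγ x y)))
             (same-tr (restrict (e P) Y) (eB (restrict P Y)) (eB S)
               (⇒same (proj₂ (restrict (e P) Y)) (e (proj₂ (restrict P Y))) (λ i j → sym (cutY P isP X c i j)))
               (eB-same (restrict P Y) S hS))

    -- Both P and P' have a cut of the size of R; the cuts agree by
    -- cut-unique, and then P and P' agree on both sides and across.
    fibre-unique : ∀ P P' → fibreStar P ≡ true → fibreStar P' ≡ true → eqR P' P ≡ true
    fibre-unique P P' h h' with inStar→ P R S (∧T₂ {isPosetᵇ P ∧ sameᵇ (p , e P) (p , γ)} h)
                      | inStar→ P' R S (∧T₂ {isPosetᵇ P' ∧ sameᵇ (p , e P') (p , γ)} h')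
    ... | X , c , hR , hS | X' , c' , hR' , hS' = T-eqR P' P
          (TwoSided.determination X P' P cP' c
            (λ i j → same⇒ (proj₂ (restrict P' X)) (proj₂ (restrict P X)) sameX i j)
            (λ i j → same⇒ (proj₂ (restrict P' Y)) (proj₂ (restrict P Y)) sameY i j))
      where
      Y : Fin p → Bool
      Y x = not (X x)
      isP = posetT P (∧T₁ (∧T₁ h))
      isP' = posetT P' (∧T₁ (∧T₁ h'))
      eqγ : e P ≗₂ γ
      eqγ = same⇒ (e P) γ (∧T₂ {isPosetᵇ P} (∧T₁ h))
      eqγ' : e P' ≗₂ γ
      eqγ' = same⇒ (e P') γ (∧T₂ {isPosetᵇ P'} (∧T₁ h'))
      c1 : Cut γ X
      c1 = cut-respT eqγ (cutE P isP X c)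
      c2 : Cut γ X'
      c2 = cut-respT eqγ' (cutE P' isP' X' c')
      XX' : ∀ z → X z ≡ X' z
      XX' = cut-unique γ X X' c1 c2 (trans (same-size _ _ hR) (sym (same-size _ _ hR')))
      cP' : Cut P' X
      cP' = cut-respX (λ z → sym (XX' z)) c'
      sameX : sameᵇ (restrict P' X) (restrict P X) ≡ true
      sameX = same-tr (restrict P' X) (restrict P' X') (restrict P X) (restrict-same P' X X' XX')
                (same-tr (restrict P' X') R (restrict P X) hR' (same-sy (restrict P X) R hR))
      sameY : sameᵇ (restrict P' Y) (restrict P Y) ≡ true
      sameY = same-tr (restrict P' Y) (restrict P' (λ x → not (X' x))) (restrict P Y)
                (restrict-same P' Y _ (λ z → cong not (XX' z)))
                (same-tr (restrict P' _) S (restrict P Y) hS' (same-sy (restrict P Y) S hS))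

  -- The glued poset lies in the fibre: e(glued) has the cut of γ and agrees
  -- with γ on both sides, so it is γ.
  star⇒fibre : ∀ {p} (γ : Rel p) r (R̂ : Rel r) s (Ŝ : Rel s) → extStar γ (r , R̂) (s , Ŝ) ≡ true →
        Σ (Rel p) λ P → fibreStar γ (r , R̂) (s , Ŝ) P ≡ true
  star⇒fibre {p} γ r R̂ s Ŝ h with inStar→ γ (r , e R̂) (s , e Ŝ) (∧T₂ {isPosetᵇ R̂ ∧ isPosetᵇ Ŝ} h)
  ... | X , cγ , h1 , h2 with same-size (proj₂ (restrict γ X)) (e R̂) h1 | same-size (proj₂ (restrict γ (λ x → not (X x)))) (e Ŝ) h2
  ... | refl | refl = glued , T∧ (T∧ (Tposet glued posP) (⇒same (e glued) γ e-glued))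
                            (→inStar glued _ _ (X , glued-cut , ⇒same (proj₂ (restrict glued X)) R̂ glued-X , ⇒same (proj₂ (restrict glued (λ x → not (X x)))) Ŝ glued-Y))
    where
    open TwoSided X
    open Glue R̂ Ŝ
    posR̂ = posetT R̂ (∧T₁ (∧T₁ h))
    posŜ = posetT Ŝ (∧T₂ {isPosetᵇ R̂} (∧T₁ h))
    posP : IsPoset glued
    posP = cut-poset glued glued-cut (poset-resp (λ i j → sym (glued-X i j)) posR̂) (poset-resp (λ i j → sym (glued-Y i j)) posŜ)
    e-glued : e glued ≗₂ γ
    e-glued = determination (e glued) γ (cutE glued posP X glued-cut) cγ
      (λ i j → trans (sym (cutX glued posP X glued-cut i j))
                 (trans (resp (proj₂ (restrict glued X)) R̂ glued-X i j) (sym (same⇒ (proj₂ (restrict γ X)) (e R̂) h1 i j))))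
      (λ i j → trans (sym (cutY glued posP X glued-cut i j))
                 (trans (resp (proj₂ (restrict glued Y)) Ŝ glued-Y i j) (sym (same⇒ (proj₂ (restrict γ Y)) (e Ŝ) h2 i j))))

-- For a relation γ on [p], the list
-- starPairs γ contains each pair (A , B) with γ ∈ A ⋆ B and |A| + |B| = p
-- exactly once, so a sum over it of a function h that sees only sameᵇ-classes
-- is a Kronecker delta (starDelta).
module StarCoefficients {c ℓ} (K : CommutativeRing c ℓ) where

  open import Defs
  open Bookkeeping
  open DecidableRelations
  open StarMembership
  open FiniteSums K
  open Enumerations K
  open Coefficients K
  open Alg K
  open CommutativeRing K renaming (Carrier to 𝕂)
  open import Data.Bool using (Bool; true; false; _∧_; if_then_else_)
  open import Data.Nat as ℕ using (ℕ; suc; _≡ᵇ_; _∸_) renaming (_<ᵇ_ to _<ᴺ_)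
  import Data.Nat.Properties as ℕP
  open import Data.List using (List; []; _∷_; concatMap; upTo)
  open import Data.Product using (_×_; _,_; proj₁; proj₂)
  open import Relation.Binary.PropositionalEquality as P using (_≡_)

  -- |A| ≤ p and |B| = p - |A|, i.e. |A| + |B| = p
  sizesAdd : Basis → Basis → ℕ → Bool
  sizesAdd A B p = (proj₁ A <ᴺ suc p) ∧ (proj₁ B ≡ᵇ p ∸ proj₁ A)

  sizesAdd-small : ∀ A B p → proj₁ A ℕ.+ proj₁ B ℕ.< p → sizesAdd A B p ≡ false
  sizesAdd-small (r , R) (s , S) p lt = ¬T (λ h → ℕP.<-irrefl P.refl (P.subst (ℕ._< p) (sum h) lt))
    where
    sum : sizesAdd (r , R) (s , S) p ≡ true → r ℕ.+ s ≡ p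
    sum h = P.trans (P.cong (r ℕ.+_) (≡ᵇ-T s (p ∸ r) (∧T₂ {r <ᴺ suc p} h)))
                    (ℕP.m+[n∸m]≡n (ℕP.≤-pred (<ᴺ-T r (suc p) (∧T₁ h))))

  RespH : (Basis → Basis → 𝕂) → Set ℓ
  RespH h = ∀ A A' B B' → sameᵇ A A' ≡ true → sameᵇ B B' ≡ true → h A B ≈ h A' B'

  starDelta : ∀ {p} (γ : Rel p) (A B : Basis) (h : Basis → Basis → 𝕂) → RespH h →
    sumL (starPairs γ) (λ u → ⟦ sameᵇ (proj₁ u) A ∧ sameᵇ (proj₂ u) B ⟧ * h (proj₁ u) (proj₂ u))
      ≈ ⟦ sizesAdd A B p ⟧ * (⟦ inStarᵇ γ A B ⟧ * h A B)
  starDelta {p} γ A B h rh = begin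
    sumL (starPairs γ) F
      ≈⟨ sumL-concatMap perSize (upTo (suc p)) F ⟩
    sumL (upTo (suc p)) (λ m → sumL (perSize m) F)
      ≈⟨ sumL-cong (upTo (suc p)) (λ m → trans (sumL-concatMap (perR m) (allRel m) F)
                                             (sumL-cong (allRel m) (λ R → sumS m R))) ⟩
    sumL (upTo (suc p)) (λ m → sumL (allRel m) (λ R → ⟦ sameᵇ (m , R) A ⟧ * H₂ m (m , R)))
      ≈⟨ sumL-cong (upTo (suc p)) (λ m → deltaRelB m (H₂ m) (RH₂ m) A) ⟩
    sumL (upTo (suc p)) (λ m → ⟦ proj₁ A ≡ᵇ m ⟧ * H₂ m A)
      ≈⟨ deltaUpTo (suc p) (proj₁ A) (λ m → H₂ m A) ⟩
    ⟦ proj₁ A <ᴺ suc p ⟧ * (⟦ proj₁ B ≡ᵇ p ∸ proj₁ A ⟧ * (⟦ inStarᵇ γ A B ⟧ * h A B))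
      ≈⟨ trans (sym (*-assoc _ _ _)) (*-congʳ (sym (⟦∧⟧ (proj₁ A <ᴺ suc p) _))) ⟩
    ⟦ sizesAdd A B p ⟧ * (⟦ inStarᵇ γ A B ⟧ * h A B) ∎
    where
    F : Basis × Basis → 𝕂
    F u = ⟦ sameᵇ (proj₁ u) A ∧ sameᵇ (proj₂ u) B ⟧ * h (proj₁ u) (proj₂ u)
    pair? : ∀ m → Rel m → Rel (p ∸ m) → List (Basis × Basis)
    pair? m R S = if inStarᵇ γ (m , R) (p ∸ m , S) then ((m , R) , (p ∸ m , S)) ∷ [] else []
    perR : ∀ m → Rel m → List (Basis × Basis)
    perR m R = concatMap (pair? m R) (allRel (p ∸ m))
    perSize : ℕ → List (Basis × Basis)
    perSize m = concatMap (perR m) (allRel m)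
    H₁ : ∀ m → Rel m → Basis → 𝕂
    H₁ m R B' = ⟦ sameᵇ (m , R) A ⟧ * (⟦ inStarᵇ γ (m , R) B' ⟧ * h (m , R) B')
    RH₁ : ∀ m R → RespB (H₁ m R)
    RH₁ m R B₁ B₂ q = *-congˡ (*-cong (⟦≡⟧ (inStar-resp-RS γ (m , R) B₁ (m , R) B₂ (same-refl (m , R)) q))
                                      (rh (m , R) (m , R) B₁ B₂ (same-refl (m , R)) q))
    H₂ : ∀ m → Basis → 𝕂
    H₂ m A' = ⟦ proj₁ B ≡ᵇ p ∸ m ⟧ * (⟦ inStarᵇ γ A' B ⟧ * h A' B)
    RH₂ : ∀ m → RespB (H₂ m)
    RH₂ m A₁ A₂ q = *-congˡ (*-cong (⟦≡⟧ (inStar-resp-RS γ A₁ B A₂ B q (same-refl B)))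
                                    (rh A₁ A₂ B B q (same-refl B)))
    rearrange : ∀ i x y z → i * ((x * y) * z) ≈ y * (x * (i * z))
    rearrange i x y z = begin
      i * ((x * y) * z) ≈⟨ *-congˡ (*-assoc _ _ _) ⟩
      i * (x * (y * z)) ≈⟨ x∙yz≈y∙xz _ _ _ ⟩
      x * (i * (y * z)) ≈⟨ *-congˡ (x∙yz≈y∙xz _ _ _) ⟩
      x * (y * (i * z)) ≈⟨ x∙yz≈y∙xz _ _ _ ⟩
      y * (x * (i * z)) ∎
    sumS : ∀ m R → sumL (perR m R) F ≈ ⟦ sameᵇ (m , R) A ⟧ * H₂ m (m , R)
    sumS m R =
      trans (sumL-concatMap (pair? m R) (allRel (p ∸ m)) F)
      (trans (sumL-cong (allRel (p ∸ m)) (λ S →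
                 trans (sumL-if (inStarᵇ γ (m , R) (p ∸ m , S)) ((m , R) , (p ∸ m , S)) F)
                   (trans (*-congˡ (*-congʳ (⟦∧⟧ (sameᵇ (m , R) A) _))) (rearrange _ _ _ _))))
        (trans (deltaRelB (p ∸ m) (H₁ m R) (RH₁ m R) B) (x∙yz≈y∙xz _ _ _)))

  starCount : Basis → Basis → Basis → 𝕂
  starCount R S B = sumL (starPairs (proj₂ B)) (λ u → ⟦ sameᵇ (proj₁ u) R ∧ sameᵇ (proj₂ u) S ⟧)

  starCount-formula : ∀ R S p (T : Rel p) → starCount R S (p , T) ≈ ⟦ sizesAdd R S p ⟧ * ⟦ inStarᵇ T R S ⟧
  starCount-formula R S p T =
    trans (sumL-cong (starPairs T) (λ u → sym (*-identityʳ _)))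
    (trans (starDelta T R S (λ _ _ → 1#) (λ _ _ _ _ _ _ → refl)) (*-congˡ (*-identityʳ _)))

  starCount-resp : ∀ R S → RespB (starCount R S)
  starCount-resp R S (p , T) (p' , T') q with same-size T T' q
  ... | P.refl = trans (starCount-formula R S p T)
                   (trans (*-congˡ (⟦≡⟧ (inStar-resp-T T T' R S (same⇒ T T' q))))
                     (sym (starCount-formula R S p T')))

  starCount-supp : ∀ R S → Supp (proj₁ R ℕ.+ proj₁ S) (starCount R S)
  starCount-supp R S (p , T) lt =
    trans (starCount-formula R S p T) (trans (*-congʳ (⟦≡⟧ (sizesAdd-small R S p lt))) (zeroˡ _))

  Δ-coeff : ∀ x R S → coeff₂ (Δ x) R S ≈ ⟪ x , starCount R S ⟫
  Δ-coeff x R S =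
    trans (coeff₂≈ (Δ x) R S) (trans (sumL-concatMap _ x term) (sumL-cong x (λ { (a , (p , T)) →
      trans (sumL-map _ (starPairs T) term) (sym (sumL-*ˡ (starPairs T) a _)) })))
    where
    term : 𝕂 × Basis × Basis → 𝕂
    term t = proj₁ t * ⟦ sameᵇ (proj₁ (proj₂ t)) R ∧ sameᵇ (proj₂ (proj₂ t)) S ⟧

  Δ-cong : ∀ {x x'} → x ≋ x' → Δ x ≋₂ Δ x'
  Δ-cong {x} {x'} ex R S =
    trans (Δ-coeff x R S)
      (trans (pair-≋ (proj₁ R ℕ.+ proj₁ S) (starCount R S) (starCount-resp R S) (starCount-supp R S) {x} {x'} ex)
        (sym (Δ-coeff x' R S)))

-- The coproduct rule  Δ G_γ = Σ { G_α ⊗ G_β : α, β total, γ ∈ α ⋆ β }.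
-- Coefficientwise at F_R ⊗ F_S both sides equal
-- [|R| + |S| = |γ|] · [R, S posets and γ ∈ e(R) ⋆ e(S)]: the left side by
-- counting the fibre of StarFibres, the right side because only
-- (α , β) = (e(R) , e(S)) contributes.
module CoproductRule {c ℓ} (K : CommutativeRing c ℓ) (e : ∀ {n} → Rel n → Rel n) (adm : Admissibility.Admissible e) where

  open import Defs
  open Bookkeeping
  open DecidableRelations
  open StarMembership
  open StarFibres e adm
  open FiniteSums K
  open Enumerations K
  open Coefficients K
  open StarCoefficients K
  open Fibres K e adm
  open Alg K
  open Admissibility.Admissible adm using (tot)
  open CommutativeRing K renaming (Carrier to 𝕂)
  open import Data.Bool using (Bool; true; false; _∧_)
  open import Data.Nat using (_≡ᵇ_)
  open import Data.List using (List; map; concatMap; filterᵇ)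
  open import Data.List.Relation.Unary.All as All using (All)
  import Data.List.Relation.Unary.All.Properties as AllP
  open import Data.Product using (_×_; _,_; proj₁; proj₂)
  open import Relation.Binary.PropositionalEquality as P using (_≡_)

  fibre-count : ∀ {p} (γ : Rel p) R S → sumL (allRel p) (λ P → ⟦ fibreStar γ R S P ⟧) ≈ ⟦ extStar γ R S ⟧
  fibre-count γ (r , R̂) (s , Ŝ) = count-unique (fibreStar γ (r , R̂) (s , Ŝ)) (extStar γ (r , R̂) (s , Ŝ))
    (λ P P' q → P.cong₂ _∧_ (inFibre-resp γ P P' q) (inStar-resp-T P P' _ _ (eqR-T P P' q)))
    (fibre-unique γ (r , R̂) (s , Ŝ)) (star⇒fibre γ r R̂ s Ŝ) (fibre⇒star γ (r , R̂) (s , Ŝ))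

  ΔG-coeff : ∀ {p} (γ : Rel p) R S → ⟪ G e γ , starCount R S ⟫ ≈ ⟦ sizesAdd R S p ⟧ * ⟦ extStar γ R S ⟧
  ΔG-coeff {p} γ R S =
    trans (pairG γ (starCount R S))
    (trans (sumL-cong (allRel p) (λ P → trans (*-congˡ (starCount-formula R S p P))
              (trans (x∙yz≈y∙xz _ _ _) (*-congˡ (sym (⟦∧⟧ (inFibre γ P) (inStarᵇ P R S)))))))
    (trans (sym (sumL-*ˡ (allRel p) _ _)) (*-congˡ (fibre-count γ R S))))

  inFibreB : Basis → Basis → Bool
  inFibreB A B = isPosetᵇ (proj₂ B) ∧ sameᵇ (eB B) A

  inFibreB-resp : ∀ A B₁ B₂ → sameᵇ B₁ B₂ ≡ true → inFibreB A B₁ ≡ inFibreB A B₂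
  inFibreB-resp A B₁ B₂ q = P.cong₂ _∧_
    (bool-ext (λ h → poset-transfer B₁ B₂ h q) (λ h → poset-transfer B₂ B₁ h (same-sy B₁ B₂ q)))
    (same-trans (eB B₂) (eB B₁) A (eB-same B₂ B₁ (same-sy B₁ B₂ q)))

  size-drop : ∀ m (α : Rel m) B c → ⟦ proj₁ B ≡ᵇ m ⟧ * (⟦ inFibreB (m , α) B ⟧ * c) ≈ ⟦ inFibreB (m , α) B ⟧ * c
  size-drop m α (k , Q) c with inFibreB (m , α) (k , Q) in eq
  ... | false = trans (*-congˡ (zeroˡ _)) (trans (zeroʳ _) (sym (zeroˡ _)))
  ... | true with same-size (e Q) α (∧T₂ {isPosetᵇ Q} eq)
  ...   | P.refl = trans (*-congʳ (⟦≡⟧ (≡ᵇ-refl k))) (*-identityˡ _)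

  coeff-G⊗G : ∀ {m n} (α : Rel m) (β : Rel n) R S →
              coeff₂ (G e α ⊗ G e β) R S ≈ ⟦ inFibreB (m , α) R ⟧ * ⟦ inFibreB (n , β) S ⟧
  coeff-G⊗G {m} {n} α β R S =
    trans (coeff₂≈ (G e α ⊗ G e β) R S)
    (trans (sumL-concatMap _ (G e α) term)
    (trans (sumL-cong (G e α) (λ { (a , R') → trans (sumL-map _ (G e β) term)
              (trans (sumL-cong (G e β) (λ s → *-assoc _ _ _)) (sym (sumL-*ˡ (G e β) a _))) }))
    (trans (pairG α second)
    (trans (sumL-cong (allRel m) (λ P → trans (*-congˡ (second-formula P)) (regroup P)))
    (trans (deltaRelB m (λ B → ⟦ inFibreB (m , α) B ⟧ * ⟦ inFibreB (n , β) S ⟧)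
                        (λ B₁ B₂ q → *-congʳ (⟦≡⟧ (inFibreB-resp (m , α) B₁ B₂ q))) R)
      (size-drop m α R _))))))
    where
    term : 𝕂 × Basis × Basis → 𝕂
    term t = proj₁ t * ⟦ sameᵇ (proj₁ (proj₂ t)) R ∧ sameᵇ (proj₂ (proj₂ t)) S ⟧
    second : Basis → 𝕂
    second R' = ⟪ G e β , (λ S' → ⟦ sameᵇ R' R ∧ sameᵇ S' S ⟧) ⟫
    second-formula : ∀ P → second (m , P) ≈ ⟦ inFibreB (n , β) S ⟧ * ⟦ sameᵇ (m , P) R ⟧
    second-formula P = trans (pairG β _)
      (trans (sumL-cong (allRel n) (λ Q → trans (*-congˡ (⟦∧⟧ (sameᵇ (m , P) R) _))
                  (trans (*-congˡ (*-comm _ _)) (x∙yz≈y∙xz _ _ _))))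
      (trans (deltaRelB n (λ B → ⟦ inFibreB (n , β) B ⟧ * ⟦ sameᵇ (m , P) R ⟧)
                          (λ B₁ B₂ q → *-congʳ (⟦≡⟧ (inFibreB-resp (n , β) B₁ B₂ q))) S)
        (size-drop n β S _)))
    regroup : ∀ P → ⟦ inFibre α P ⟧ * (⟦ inFibreB (n , β) S ⟧ * ⟦ sameᵇ (m , P) R ⟧) ≈
                    ⟦ sameᵇ (m , P) R ⟧ * (⟦ inFibreB (m , α) (m , P) ⟧ * ⟦ inFibreB (n , β) S ⟧)
    regroup P = trans (*-congˡ (*-comm _ _)) (x∙yz≈y∙xz _ _ _)

  totalStarPairs : ∀ {p} → Rel p → List (Basis × Basis)
  totalStarPairs γ = filterᵇ (λ u → totalᵇ (proj₂ (proj₁ u)) ∧ totalᵇ (proj₂ (proj₂ u))) (starPairs γ)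

  totalStarPairs-coeff : ∀ {p} (γ : Rel p) R S →
    sumL (totalStarPairs γ) (λ u → coeff₂ (G e (proj₂ (proj₁ u)) ⊗ G e (proj₂ (proj₂ u))) R S)
      ≈ ⟦ sizesAdd R S p ⟧ * ⟦ extStar γ R S ⟧
  totalStarPairs-coeff {p} γ (r , R̂) (s , Ŝ) =
    trans (sumL-filter _ (starPairs γ) _)
    (trans (sumL-cong (starPairs γ) (λ u → trans (*-congˡ (coeff-G⊗G (proj₂ (proj₁ u)) (proj₂ (proj₂ u)) R S)) (term u)))
    (trans (starDelta γ (eB R) (eB S) h h-resp) (*-congˡ atExtensions)))
    where
    R = (r , R̂)
    S = (s , Ŝ)
    h : Basis → Basis → 𝕂
    h α β = ⟦ totalᵇ (proj₂ α) ∧ totalᵇ (proj₂ β) ⟧ * (⟦ isPosetᵇ R̂ ⟧ * ⟦ isPosetᵇ Ŝ ⟧)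
    h-resp : RespH h
    h-resp A A' B B' qa qb = *-congʳ (⟦≡⟧ (P.cong₂ _∧_ (total-transfer A A' qa) (total-transfer B B' qb)))
    term : ∀ u → ⟦ totalᵇ (proj₂ (proj₁ u)) ∧ totalᵇ (proj₂ (proj₂ u)) ⟧ * (⟦ inFibreB (proj₁ u) R ⟧ * ⟦ inFibreB (proj₂ u) S ⟧)
                 ≈ ⟦ sameᵇ (proj₁ u) (eB R) ∧ sameᵇ (proj₂ u) (eB S) ⟧ * h (proj₁ u) (proj₂ u)
    term u = begin
      ⟦ tt ⟧ * (⟦ isPosetᵇ R̂ ∧ sameᵇ (eB R) (proj₁ u) ⟧ * ⟦ isPosetᵇ Ŝ ∧ sameᵇ (eB S) (proj₂ u) ⟧)
        ≈⟨ *-congˡ (*-cong (⟦∧⟧ (isPosetᵇ R̂) _) (⟦∧⟧ (isPosetᵇ Ŝ) _)) ⟩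
      ⟦ tt ⟧ * ((⟦ isPosetᵇ R̂ ⟧ * ⟦ sameᵇ (eB R) (proj₁ u) ⟧) * (⟦ isPosetᵇ Ŝ ⟧ * ⟦ sameᵇ (eB S) (proj₂ u) ⟧))
        ≈⟨ *-congˡ (interchange _ _ _ _) ⟩
      ⟦ tt ⟧ * ((⟦ isPosetᵇ R̂ ⟧ * ⟦ isPosetᵇ Ŝ ⟧) * (⟦ sameᵇ (eB R) (proj₁ u) ⟧ * ⟦ sameᵇ (eB S) (proj₂ u) ⟧))
        ≈⟨ trans (sym (*-assoc _ _ _)) (*-comm _ _) ⟩
      (⟦ sameᵇ (eB R) (proj₁ u) ⟧ * ⟦ sameᵇ (eB S) (proj₂ u) ⟧) * h (proj₁ u) (proj₂ u)
        ≈⟨ *-congʳ (trans (*-cong (⟦≡⟧ (same-sym (eB R) (proj₁ u))) (⟦≡⟧ (same-sym (eB S) (proj₂ u))))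
                          (sym (⟦∧⟧ (sameᵇ (proj₁ u) (eB R)) (sameᵇ (proj₂ u) (eB S))))) ⟩
      ⟦ sameᵇ (proj₁ u) (eB R) ∧ sameᵇ (proj₂ u) (eB S) ⟧ * h (proj₁ u) (proj₂ u) ∎
      where tt = totalᵇ (proj₂ (proj₁ u)) ∧ totalᵇ (proj₂ (proj₂ u))
    -- e(R) and e(S) are total orders as soon as R and S are posets
    atExtensions : ⟦ inStarᵇ γ (eB R) (eB S) ⟧ * h (eB R) (eB S) ≈ ⟦ extStar γ R S ⟧
    atExtensions with isPosetᵇ R̂ in e1 | isPosetᵇ Ŝ in e2
    ... | true | true rewrite Ttotal (e R̂) (tot R̂ (posetT R̂ e1)) | Ttotal (e Ŝ) (tot Ŝ (posetT Ŝ e2)) =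
          trans (*-congˡ (trans (*-identityˡ _) (*-identityˡ _))) (*-identityʳ _)
    ... | true | false = trans (*-congˡ (trans (*-congˡ (zeroʳ _)) (zeroʳ _))) (zeroʳ _)
    ... | false | _ = trans (*-congˡ (trans (*-congˡ (zeroˡ _)) (zeroʳ _))) (zeroʳ _)

  coproduct-rule : ∀ {p} (γ : Rel p) R S →
    ⟪ G e γ , starCount R S ⟫ ≈ sumL (totalStarPairs γ) (λ u → coeff₂ (G e (proj₂ (proj₁ u)) ⊗ G e (proj₂ (proj₂ u))) R S)
  coproduct-rule γ R S = trans (ΔG-coeff γ R S) (sym (totalStarPairs-coeff γ R S))

  coproductTerms : List (𝕂 × Basis) → List (𝕂 × Basis × Basis)
  coproductTerms Lx = concatMap (λ t → map (λ u → (proj₁ t , proj₁ u , proj₂ u)) (totalStarPairs (proj₂ (proj₂ t)))) Lx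

  G⊗G : 𝕂 × Basis × Basis → Elt₂
  G⊗G t = proj₁ t •₂ (G e (proj₂ (proj₁ (proj₂ t))) ⊗ G e (proj₂ (proj₂ (proj₂ t))))

  coproductTerms-total : ∀ Lx → All (λ t → IsTotalOrder (proj₂ (proj₁ (proj₂ t))) × IsTotalOrder (proj₂ (proj₂ (proj₂ t))))
                                    (coproductTerms Lx)
  coproductTerms-total Lx = All-concatMap _ Lx (λ t →
    AllP.map⁺ (All.map (λ {u} q → totalT _ (∧T₁ q) , totalT _ (∧T₂ {totalᵇ (proj₂ (proj₁ u))} q))
                       (All-filterᵇ _ (starPairs (proj₂ (proj₂ t))))))

  coprod-span : ∀ x Lx → x ≋ concatMap Gt Lx → Δ x ≋₂ concatMap G⊗G (coproductTerms Lx)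
  coprod-span x Lx ex R S = begin
    coeff₂ (Δ x) R S
      ≈⟨ Δ-cong {x} {concatMap Gt Lx} ex R S ⟩
    coeff₂ (Δ (concatMap Gt Lx)) R S
      ≈⟨ Δ-coeff (concatMap Gt Lx) R S ⟩
    ⟪ concatMap Gt Lx , starCount R S ⟫
      ≈⟨ pair-Gt Lx (starCount R S) ⟩
    sumL Lx (λ t → proj₁ t * ⟪ G e (proj₂ (proj₂ t)) , starCount R S ⟫)
      ≈⟨ sumL-cong Lx (λ t → *-congˡ (coproduct-rule (proj₂ (proj₂ t)) R S)) ⟩
    sumL Lx (λ t → proj₁ t * sumL (totalStarPairs (proj₂ (proj₂ t))) (λ u → coeff₂ (G⊗ u) R S))
      ≈⟨ sym expandTerms ⟩
    coeff₂ (concatMap G⊗G (coproductTerms Lx)) R S ∎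
    where
    G⊗ : Basis × Basis → Elt₂
    G⊗ u = G e (proj₂ (proj₁ u)) ⊗ G e (proj₂ (proj₂ u))
    expandTerms : coeff₂ (concatMap G⊗G (coproductTerms Lx)) R S ≈
                  sumL Lx (λ t → proj₁ t * sumL (totalStarPairs (proj₂ (proj₂ t))) (λ u → coeff₂ (G⊗ u) R S))
    expandTerms =
      trans (coeff₂≈ (concatMap G⊗G (coproductTerms Lx)) R S)
      (trans (pair₂-concatMap G⊗G (coproductTerms Lx) _)
      (trans (sumL-concatMap _ Lx _)
      (sumL-cong Lx (λ t → trans (sumL-map _ (totalStarPairs (proj₂ (proj₂ t))) _)
         (trans (sumL-cong (totalStarPairs (proj₂ (proj₂ t))) (λ u →
                  trans (sym (coeff₂≈ (G⊗G (proj₁ t , proj₁ u , proj₂ u)) R S)) (coeff₂-•₂ (proj₁ t) (G⊗ u) R S)))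
           (sym (sumL-*ˡ (totalStarPairs (proj₂ (proj₂ t))) (proj₁ t) _)))))))

module SpanClosure {c ℓ} (K : CommutativeRing c ℓ) (e : ∀ {n} → Rel n → Rel n) (adm : Admissibility.Admissible e) where

  open Alg K
  open ProductRule K e adm using (productTerms; productTerms-total; prod-span)
  open CoproductRule K e adm using (coproductTerms; coproductTerms-total; coprod-span)

  product-closed : ∀ x y → InSpan e x → InSpan e y → InSpan e (x · y)
  product-closed x y (Lx , _ , ex) (Ly , _ , ey) =
    productTerms Lx Ly , productTerms-total Lx Ly , prod-span x y Lx Ly ex ey

  coproduct-closed : ∀ x → InSpan e x → InSpan₂ e (Δ x)
  coproduct-closed x (Lx , _ , ex) = coproductTerms Lx , coproductTerms-total Lx , coprod-span x Lx ex

mainTheorem18 : ∀ {c ℓ} (K : CommutativeRing c ℓ) → IsField K →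
    let open Alg K in
      ((∀ x y → InSpan eI x → InSpan eI y → InSpan eI (x · y))
        × (∀ x → InSpan eI x → InSpan₂ eI (Δ x)))
      × ((∀ x y → InSpan eD x → InSpan eD y → InSpan eD (x · y))
        × (∀ x → InSpan eD x → InSpan₂ eD (Δ x)))
mainTheorem18 K _ =
  (product-closed K eI eI-admissible , coproduct-closed K eI eI-admissible) ,
  (product-closed K eD eD-admissible , coproduct-closed K eD eD-admissible)
  where
  open SpanClosure using (product-closed; coproduct-closed)
  open Admissibility using (eI-admissible; eD-admissible)
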